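{- Let $\mathbb{K}$ be any field and consider in $\mathbb{K}((t^{ -1}))$ the infinite continued fractions $$\beta=[0;t,t^5,t^9,t^{13},\ldots]\quad\text{and}\quad\gamma=[0;t^3,t^7,t^{11},t^{15},\ldots],$$ i.e. $\beta=[0;b_1,b_2,\ldots]$ with $b_n=t^{4n-3}$ and $\gamma=[0;c_1,c_2,\ldots]$ with $c_n=t^{4n-1}$, and put $\alpha=\beta+\gamma$. Then applying to $\alpha$ the decomposition procedure below yields exactly the polynomials $b_n=t^{4n-3}$ and $c_n=t^{4n-1}$ for all $n\geq1$, and hence returns the pair $\beta,\gamma$. The procedure (for $\alpha$ with $a_0(\alpha)=0$): for $n=0,1,2,\ldots$, with $b_1,\ldots,b_n,c_1,\ldots,c_n$ already defined: if $\alpha=[0;b_1,\ldots,b_n]+[0;c_1,\ldots,c_n]$, output $\beta=[0;b_1,\ldots,b_n]$, $\gamma=[0;c_1,\ldots,c_n]$ and stop; otherwise set $b_{n+1}=a_{n+1}(\alpha-[0;c_1,\ldots,c_n])$. If then $\alpha=[0;b_1,\ldots,b_{n+1}]+[0;c_1,\ldots,c_n]$, output $\beta=[0;b_1,\ldots,b_{n+1}]$, $\gamma=[0;c_1,\ldots,c_n]$ and stop; otherwise set $c_{n+1}=a_{n+1}(\alpha-[0;b_1,\ldots,b_{n+1}])$. If it never stops, output $\beta=[0;b_1,b_2,\ldots]$, $\gamma=[0;c_1,c_2,\ldots]$.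
   Context: For a field $\mathbb{K}$, $\mathbb{K}((t^{ -1}))$ denotes the field of Laurent series $\sum_{n=-\infty}^{\infty}\alpha_n t^{ -n}$ with $\alpha_n\in\mathbb{K}$ and only finitely many nonzero $\alpha_n$ with $n<0$, with absolute value $|\alpha|=2^{\deg\alpha}$. Every $\alpha$ has a unique continued fraction expansion $\alpha=[a_0;a_1,a_2,\dots]$ with $a_n\in\mathbb{K}[t]$, $\deg a_n\geq1$ for $n\geq1$; $a_n(\alpha)$ denotes its $n$th partial quotient (when defined). $[0;b_1,\ldots,b_n]$ denotes the finite continued fraction with the given partial quotients, and $[0;]=0$. -}

module Defs where

open import Level using (Level; _⊔_) renaming (suc to lsuc)
open import Algebra.Bundles using (CommutativeRing)
open import Data.Nat as ℕ using (ℕ; zero; suc)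
open import Data.Integer as ℤ using (ℤ; +_; -[1+_]; 0ℤ; 1ℤ)
open import Data.Integer.Properties as ℤP using ()
open import Data.Bool using (Bool; true; false; if_then_else_)
open import Data.List using (List; []; _∷_; map; upTo)
open import Data.Product using (Σ; ∃; _×_; _,_)
open import Relation.Nullary using (¬_; yes; no)
open import Relation.Nullary.Decidable using (⌊_⌋)
open import Data.Empty using (⊥-elim)

record Field (c ℓ : Level) : Set (lsuc (c ⊔ ℓ)) where
  field
    commutativeRing : CommutativeRing c ℓ
  open CommutativeRing commutativeRing public
  field
    0≉1 : ¬ (0# ≈ 1#)
    inverse : ∀ x → ¬ (x ≈ 0#) → ∃ λ y → (x * y) ≈ 1#

-- Laurent series in t⁻¹ over a field K:  Σ_{k ≤ d} x_k t^k.

module Laurent {c ℓ : Level} (K : Field c ℓ) where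
  open Field K renaming (_+_ to _+K_; _*_ to _*K_; -_ to -K_)

  record LS : Set (c ⊔ ℓ) where
    field
      coeff  : ℤ → Carrier
      bound  : ℤ
      vanish : ∀ k → bound ℤ.< k → coeff k ≈ 0#
  open LS public

  _≈L_ : LS → LS → Set ℓ
  x ≈L y = ∀ k → coeff x k ≈ coeff y k

  cut : ℤ → (ℤ → Carrier) → ℤ → Carrier
  cut d f k = if ⌊ k ℤP.≤? d ⌋ then f k else 0#

  cut-vanish : ∀ d f k → d ℤ.< k → cut d f k ≈ 0#
  cut-vanish d f k d<k with k ℤP.≤? d
  ... | yes k≤d = ⊥-elim (ℤP.<⇒≱ d<k k≤d)
  ... | no _ = refl

  mkLS : ℤ → (ℤ → Carrier) → LS
  mkLS d f = record { coeff = cut d f ; bound = d ; vanish = cut-vanish d f }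

  sumFrom : (ℤ → Carrier) → ℤ → ℕ → Carrier
  sumFrom f a zero = 0#
  sumFrom f a (suc n) = f a +K sumFrom f (a ℤ.+ 1ℤ) n

  clip : ℤ → ℕ
  clip (+ n) = n
  clip -[1+ n ] = 0

  0L : LS
  0L = mkLS 0ℤ (λ _ → 0#)

  tpow : ℕ → LS
  tpow m = mkLS (+ m) (λ k → if ⌊ k ℤ.≟ + m ⌋ then 1# else 0#)

  1L : LS
  1L = tpow 0

  _+L_ : LS → LS → LS
  x +L y = mkLS (bound x ℤ.⊔ bound y) (λ k → coeff x k +K coeff y k)

  -L_ : LS → LS
  -L x = mkLS (bound x) (λ k → -K coeff x k)

  _-L_ : LS → LS → LS
  x -L y = x +L (-L y)

  _*L_ : LS → LS → LS
  x *L y = mkLS (bound x ℤ.+ bound y)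
    (λ k → sumFrom (λ i → coeff x i *K coeff y (k ℤ.- i))
                   (k ℤ.- bound y)
                   (clip (bound x ℤ.+ bound y ℤ.- k ℤ.+ 1ℤ)))

  -- a is the polynomial part of x: a ∈ K[t] and |x - a| < 1.
  PolyPart : LS → LS → Set ℓ
  PolyPart a x = (∀ k → k ℤ.< 0ℤ → coeff a k ≈ 0#)
               × (∀ k → 0ℤ ℤ.≤ k → coeff a k ≈ coeff x k)

  -- PQ n x p :  the n-th partial quotient a_n(x) is defined and equals p.
  -- x_0 = x, a_k = polynomial part of x_k, x_{k+1} = 1/(x_k - a_k)
  -- (x_{k+1} exists only when x_k - a_k ≠ 0, witnessed by the product = 1).
  PQ : ℕ → LS → LS → Set (c ⊔ ℓ)
  PQ zero x p = Level.Lift (c ⊔ ℓ) (PolyPart p x)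
  PQ (suc n) x p = Σ LS λ a → Σ LS λ y →
    PolyPart a x × ((x -L a) *L y) ≈L 1L × PQ n y p

  HasCF : LS → (ℕ → LS) → Set (c ⊔ ℓ)
  HasCF x a = ∀ n → PQ n x (a n)

  -- FinCF bs v :  v = [0; b_1, ..., b_n]  where bs = b_1 ∷ ... ∷ b_n
  -- ([0;] = 0 and [0; b_1, b_2, ...] = 1 / (b_1 + [0; b_2, ...])).
  FinCF : List LS → LS → Set (c ⊔ ℓ)
  FinCF [] v = Level.Lift (c ⊔ ℓ) (v ≈L 0L)
  FinCF (b ∷ bs) v = Σ LS λ w → FinCF bs w × ((b +L w) *L v) ≈L 1L

  bPoly cPoly : ℕ → LS          -- bPoly k = b_{k+1}, cPoly k = c_{k+1}
  bPoly k = tpow (4 ℕ.* k ℕ.+ 1)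
  cPoly k = tpow (4 ℕ.* k ℕ.+ 3)

  bSeq cSeq : ℕ → LS
  bSeq zero = 0L
  bSeq (suc k) = bPoly k
  cSeq zero = 0L
  cSeq (suc k) = cPoly k

  bList cList : ℕ → List LS
  bList n = map bPoly (upTo n)
  cList n = map cPoly (upTo n)

  -- Step n of the decomposition procedure applied to α, given that the
  -- previously produced polynomials are b_1..b_n, c_1..c_n:
  --  (i)   α ≠ [0;b_1..b_n] + [0;c_1..c_n]           (no stop)
  --  (ii)  a_{n+1}(α - [0;c_1..c_n]) = b_{n+1}
  --  (iii) α ≠ [0;b_1..b_{n+1}] + [0;c_1..c_n]       (no stop)
  --  (iv)  a_{n+1}(α - [0;b_1..b_{n+1}]) = c_{n+1}
  ProcedureStep : LS → ℕ → Set (c ⊔ ℓ)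
  ProcedureStep α n =
      (∀ u v → FinCF (bList n) u → FinCF (cList n) v → ¬ (α ≈L (u +L v)))
    × (∀ v → FinCF (cList n) v → PQ (suc n) (α -L v) (bPoly n))
    × (∀ u v → FinCF (bList (suc n)) u → FinCF (cList n) v → ¬ (α ≈L (u +L v)))
    × (∀ u → FinCF (bList (suc n)) u → PQ (suc n) (α -L u) (cPoly n))

module Submission where

-- Write βₙ = [0; b₁, …, bₙ] and γₙ = [0; c₁, …, cₙ]. For a continued fraction
-- x = [0; a₁, a₂, …] with monic partial quotients, x - [0; a₁, …, aₙ] has degree
-- -(2 deg qₙ + deg aₙ₊₁) and leading coefficient (-1)ⁿ, where deg qₙ = deg a₁ + … + deg aₙ;
-- and the partial quotients a₀, …, aₙ of x survive any perturbation of degree < -2 deg qₙ.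
-- For β and γ these degrees interleave:
--   deg (β - βₙ) = -(4n² + 2n + 1) > deg (γ - γₙ) = -(4n² + 6n + 3) > deg (β - βₙ₊₁),
-- and deg (γ - γₙ) and deg (β - βₙ₊₁) are exactly the thresholds for β and γ at step n + 1.
-- Hence α - γₙ = β + (γ - γₙ) has the partial quotients of β up to bₙ₊₁, α - βₙ₊₁ those
-- of γ up to cₙ₊₁, and the procedure never stops, since α = u + v would make the two
-- errors β - u and γ - v, of different degrees, cancel.

open import Level using (Level)
open import Data.Nat using (ℕ)
open import Defs

open import Data.Nat as ℕ using (zero; suc)
import Data.Nat.Properties as ℕP
import Data.Nat.Tactic.RingSolver as ℕ-Solver
open import Data.Integer as ℤ using (ℤ; +_; -[1+_]; 0ℤ; 1ℤ; _≤_; _<_)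
  renaming (_+_ to _+ℤ_; _-_ to _-ℤ_; -_ to -ℤ_)
import Data.Integer.Properties as ℤP
open import Data.Integer.Tactic.RingSolver using (solve-∀)
open import Data.Bool using (if_then_else_)
open import Data.List using (applyUpTo)
open import Data.List.Properties using (map-applyUpTo)
open import Data.Product using (_×_; _,_)
open import Data.Empty using (⊥-elim)
open import Function using (_∘_; id)
open import Relation.Nullary using (¬_; Dec; yes; no)
open import Relation.Nullary.Decidable using (⌊_⌋)
import Relation.Binary.PropositionalEquality as PE
open PE using (_≡_; _≢_)
open import Relation.Binary.Structures using (IsEquivalence)
import Relation.Binary.Reasoning.Setoid as SetoidReasoning
open import Algebra.Bundles using (Semiring; Ring; CommutativeRing; CommutativeMonoid)
import Algebra.Properties.Ring as RingProperties
import Algebra.Properties.CommutativeSemigroup as CommutativeSemigroupProperties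
import Algebra.Definitions.RawSemiring as RawSemiringDefinitions

+1≤⇒< : ∀ {i j} → i +ℤ 1ℤ ≤ j → i < j
+1≤⇒< {i} p = ℤP.suc[i]≤j⇒i<j (PE.subst (_≤ _) (ℤP.+-comm i 1ℤ) p)

<⇒+1≤ : ∀ {i j} → i < j → i +ℤ 1ℤ ≤ j
<⇒+1≤ {i} p = PE.subst (_≤ _) (ℤP.+-comm 1ℤ i) (ℤP.i<j⇒suc[i]≤j p)

≤-by-difference : ∀ {i j i′ j′} → j′ -ℤ i′ ≡ j -ℤ i → i ≤ j → i′ ≤ j′
≤-by-difference d p = ℤP.0≤i-j⇒j≤i (PE.subst (0ℤ ≤_) (PE.sym d) (ℤP.i≤j⇒0≤j-i p))

<-by-difference : ∀ {i j i′ j′} → j′ -ℤ i′ ≡ j -ℤ i → i < j → i′ < j′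
<-by-difference {i} {j} {i′} {j′} d p =
  +1≤⇒< (≤-by-difference (PE.trans (shift j′ i′) (PE.trans (PE.cong (_-ℤ 1ℤ) d) (PE.sym (shift j i))))
                         (<⇒+1≤ p))
  where
  shift : ∀ b a → b -ℤ (a +ℤ 1ℤ) ≡ (b -ℤ a) -ℤ 1ℤ
  shift = solve-∀

[a+1]+n≡a+suc[n] : ∀ a n → (a +ℤ 1ℤ) +ℤ + n ≡ a +ℤ + suc n
[a+1]+n≡a+suc[n] a n = PE.trans (ℤP.+-assoc a 1ℤ (+ n)) (PE.cong (a +ℤ_) (PE.sym (ℤP.pos-+ 1 n)))

+-cancelˡ-≤ : ∀ a {i j} → a +ℤ i ≤ a +ℤ j → i ≤ j
+-cancelˡ-≤ a {i} {j} = ≤-by-difference (difference a i j)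
  where
  difference : ∀ a i j → j -ℤ i ≡ (a +ℤ j) -ℤ (a +ℤ i)
  difference = solve-∀

i-1+1≡i : ∀ i → i -ℤ 1ℤ +ℤ 1ℤ ≡ i
i-1+1≡i = solve-∀

-[1+m]≡-1-m : ∀ m → -[1+ m ] ≡ -ℤ 1ℤ -ℤ + m
-[1+m]≡-1-m zero = PE.refl
-[1+m]≡-1-m (suc m) = PE.refl

-[1+a+r]+a≡-[1+r] : ∀ a r → -[1+ a ℕ.+ r ] +ℤ + a ≡ -[1+ r ]
-[1+a+r]+a≡-[1+r] a r =
  PE.trans (PE.cong (_+ℤ + a) (PE.trans (-[1+m]≡-1-m (a ℕ.+ r)) (PE.cong (λ m → -ℤ 1ℤ -ℤ m) (ℤP.pos-+ a r))))
           (PE.trans (cancel (+ a) (+ r)) (PE.sym (-[1+m]≡-1-m r)))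
  where
  cancel : ∀ a r → (-ℤ 1ℤ -ℤ (a +ℤ r)) +ℤ a ≡ -ℤ 1ℤ -ℤ r
  cancel = solve-∀

-ℤ+n≤0 : ∀ n → -ℤ + n ≤ 0ℤ
-ℤ+n≤0 n = ℤP.neg-mono-≤ (ℤ.+≤+ ℕ.z≤n)

-neg<-neg : ∀ {a b} → a ℕ.< b → -ℤ + b < -ℤ + a
-neg<-neg a<b = ℤP.neg-mono-< (ℤ.+<+ a<b)

module GeometricSum {a ℓ : Level} (R : Ring a ℓ) where
  open Ring R
  open RingProperties R using (\\-leftDividesʳ; [y-z]x≈yx-zx)
  open RawSemiringDefinitions (Semiring.rawSemiring semiring) using (_^_)
  open SetoidReasoning setoid

  geometric : Carrier → ℕ → Carrier
  geometric u zero = 1#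
  geometric u (suc N) = geometric u N + u ^ suc N

  geometric-telescope : ∀ u N → (1# - u) * geometric u N ≈ 1# - u ^ suc N
  geometric-telescope u zero = begin
    (1# - u) * 1#   ≈⟨ *-identityʳ _ ⟩
    1# - u          ≈⟨ +-congˡ (-‿cong (*-identityʳ u)) ⟨
    1# - u * 1#     ∎
  geometric-telescope u (suc N) = begin
    (1# - u) * (G + P)                ≈⟨ distribˡ _ G P ⟩
    (1# - u) * G + (1# - u) * P       ≈⟨ +-cong (geometric-telescope u N) ([y-z]x≈yx-zx P 1# u) ⟩
    (1# - P) + (1# * P - u * P)       ≈⟨ +-congˡ (+-congʳ (*-identityˡ P)) ⟩
    (1# - P) + (P - u * P)            ≈⟨ +-assoc 1# (- P) _ ⟩
    1# + (- P + (P - u * P))          ≈⟨ +-congˡ (\\-leftDividesʳ P (- (u * P))) ⟩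
    1# - u * P                        ∎
    where
    G = geometric u N
    P = u ^ suc N

module ReciprocalIdentities {a ℓ : Level} (R : CommutativeRing a ℓ) where
  open CommutativeRing R
  open RingProperties ring using (x[y-z]≈xy-xz; -‿distribʳ-*; ⁻¹-anti-homo‿-; xyx⁻¹≈y; -‿+-comm; \\-leftDividesˡ)
  open SetoidReasoning setoid

  reciprocal-difference : ∀ p x x′ u w → (p + w) * u ≈ 1# → x * (p + x′) ≈ 1# →
                          x - u ≈ - ((x * u) * (x′ - w))
  reciprocal-difference p x x′ u w [p+w]u≈1 x[p+x′]≈1 = begin
    x - u                                        ≈⟨ +-cong x≈ (-‿cong u≈) ⟩
    x * ((p + w) * u) - (x * (p + x′)) * u       ≈⟨ +-cong (rearrange (p + w)) (-‿cong (*-assoc x (p + x′) u)) ⟩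
    (x * u) * (p + w) - x * ((p + x′) * u)       ≈⟨ +-congˡ (-‿cong (rearrange (p + x′))) ⟩
    (x * u) * (p + w) - (x * u) * (p + x′)       ≈⟨ x[y-z]≈xy-xz (x * u) (p + w) (p + x′) ⟨
    (x * u) * ((p + w) - (p + x′))               ≈⟨ *-congˡ cancel-p ⟩
    (x * u) * - (x′ - w)                         ≈⟨ -‿distribʳ-* (x * u) (x′ - w) ⟨
    - ((x * u) * (x′ - w))                       ∎
    where
    x≈ : x ≈ x * ((p + w) * u)
    x≈ = sym (trans (*-congˡ [p+w]u≈1) (*-identityʳ x))
    u≈ : u ≈ (x * (p + x′)) * u
    u≈ = sym (trans (*-congʳ x[p+x′]≈1) (*-identityˡ u))
    rearrange : ∀ q → x * (q * u) ≈ (x * u) * q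
    rearrange q = trans (*-congˡ (*-comm q u)) (sym (*-assoc x u q))
    cancel-p : (p + w) - (p + x′) ≈ - (x′ - w)
    cancel-p = begin
      (p + w) - (p + x′)             ≈⟨ +-congˡ (-‿+-comm p x′) ⟨
      (p + w) + (- p + - x′)         ≈⟨ +-assoc (p + w) (- p) (- x′) ⟨
      ((p + w) - p) - x′             ≈⟨ +-congʳ (xyx⁻¹≈y p w) ⟩
      w - x′                         ≈⟨ ⁻¹-anti-homo‿- x′ w ⟨
      - (x′ - w)                     ∎

  reciprocal-perturbation : ∀ r ε x₁ w → r * x₁ ≈ 1# → (1# + ε * x₁) * w ≈ 1# → (r + ε) * (x₁ * w) ≈ 1#
  reciprocal-perturbation r ε x₁ w rx₁≈1 [1+εx₁]w≈1 = begin
    (r + ε) * (x₁ * w)          ≈⟨ *-assoc (r + ε) x₁ w ⟨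
    ((r + ε) * x₁) * w          ≈⟨ *-congʳ (distribʳ x₁ r ε) ⟩
    (r * x₁ + ε * x₁) * w       ≈⟨ *-congʳ (+-congʳ rx₁≈1) ⟩
    (1# + ε * x₁) * w           ≈⟨ [1+εx₁]w≈1 ⟩
    1#                          ∎

  reciprocal-perturbation-difference : ∀ ε x₁ w → (1# + ε * x₁) * w ≈ 1# → x₁ * w - x₁ ≈ - (x₁ * ((ε * x₁) * w))
  reciprocal-perturbation-difference ε x₁ w [1+εx₁]w≈1 = begin
    x₁ * w - x₁                                  ≈⟨ +-congˡ (-‿cong x₁≈) ⟩
    x₁ * w - x₁ * (w + (ε * x₁) * w)             ≈⟨ +-congˡ (-‿cong (distribˡ x₁ w ((ε * x₁) * w))) ⟩
    x₁ * w - (x₁ * w + x₁ * ((ε * x₁) * w))      ≈⟨ +-congˡ (-‿+-comm (x₁ * w) _) ⟨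
    x₁ * w + (- (x₁ * w) - x₁ * ((ε * x₁) * w))  ≈⟨ \\-leftDividesˡ (x₁ * w) _ ⟩
    - (x₁ * ((ε * x₁) * w))                      ∎
    where
    x₁≈ : x₁ ≈ x₁ * (w + (ε * x₁) * w)
    x₁≈ = sym (trans (*-congˡ (trans (+-congʳ (sym (*-identityˡ w))) (sym (distribʳ w 1# (ε * x₁)))))
                     (trans (*-congˡ [1+εx₁]w≈1) (*-identityʳ x₁)))

module LaurentRing {c ℓ : Level} (K : Field c ℓ) where
  open Laurent K public
  open Field K using (Carrier; _≈_; 0#; 1#; setoid; refl; reflexive; sym; trans;
    +-cong; +-comm; +-assoc; +-identityˡ; +-identityʳ; *-cong; *-comm; *-assoc;
    *-identityˡ; zeroˡ; zeroʳ; distribˡ; -‿cong; -‿inverseʳ)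
    renaming (_+_ to _+K_; _*_ to _*K_; -_ to -K_)
  open SetoidReasoning setoid
  open CommutativeSemigroupProperties (CommutativeMonoid.commutativeSemigroup (Field.+-commutativeMonoid K))
    using () renaming (interchange to +-interchange)

  module KP = RingProperties (CommutativeRing.ring (Field.commutativeRing K))

  +clip : ∀ {i} → 0ℤ ≤ i → + clip i ≡ i
  +clip {+ n} _ = PE.refl

  clip-nonpos : ∀ {i} → i ≤ 0ℤ → clip i ≡ 0
  clip-nonpos {+ zero} _ = PE.refl
  clip-nonpos { -[1+ n ]} _ = PE.refl
  clip-nonpos {+ suc n} (ℤ.+≤+ ())

  nonpos≡-clip : ∀ {k} → k ≤ 0ℤ → k ≡ -ℤ + clip (-ℤ k)
  nonpos≡-clip {k} k≤0 = PE.trans (PE.sym (ℤP.neg-involutive k)) (PE.cong -ℤ_ (PE.sym (+clip (ℤP.neg-mono-≤ k≤0))))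

  ≤+clip : ∀ i → i ≤ + clip i
  ≤+clip (+ n) = ℤP.≤-refl
  ≤+clip -[1+ n ] = ℤ.-≤+

  -- Finite sums

  sumFrom-cong : ∀ {f g} a n → (∀ i → f i ≈ g i) → sumFrom f a n ≈ sumFrom g a n
  sumFrom-cong a zero h = refl
  sumFrom-cong a (suc n) h = +-cong (h a) (sumFrom-cong (a +ℤ 1ℤ) n h)

  sumFrom-zero : ∀ f a n → (∀ i → a ≤ i → f i ≈ 0#) → sumFrom f a n ≈ 0#
  sumFrom-zero f a zero h = refl
  sumFrom-zero f a (suc n) h =
    trans (+-cong (h a ℤP.≤-refl) (sumFrom-zero f (a +ℤ 1ℤ) n (λ i p → h i (ℤP.≤-trans (ℤP.i≤i+j a 1ℤ) p))))
          (+-identityˡ 0#)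

  sumFrom-truncate : ∀ f a n N → (∀ i → a +ℤ + n ≤ i → f i ≈ 0#) → n ℕ.≤ N →
                     sumFrom f a N ≈ sumFrom f a n
  sumFrom-truncate f a zero N h _ =
    sumFrom-zero f a N (λ i p → h i (PE.subst (_≤ i) (PE.sym (ℤP.+-identityʳ a)) p))
  sumFrom-truncate f a (suc n) (suc N) h (ℕ.s≤s p) =
    +-cong refl (sumFrom-truncate f (a +ℤ 1ℤ) n N (λ i q → h i (PE.subst (_≤ i) ([a+1]+n≡a+suc[n] a n) q)) p)

  Supported : (ℤ → Carrier) → ℤ → ℕ → Set ℓ
  Supported f a n = (∀ i → i < a → f i ≈ 0#) × (∀ i → a +ℤ + n ≤ i → f i ≈ 0#)

  sumFrom-shrink : ∀ f A N a n → Supported f a n → A ≤ a → a +ℤ + n ≤ A +ℤ + N →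
                   sumFrom f A N ≈ sumFrom f a n
  sumFrom-shrink f A zero a n (_ , above) A≤a a+n≤A =
    sym (sumFrom-zero f a n (λ i a≤i → above i (ℤP.≤-trans a+n≤A
          (ℤP.≤-trans (ℤP.≤-reflexive (ℤP.+-identityʳ A)) (ℤP.≤-trans A≤a a≤i)))))
  sumFrom-shrink f A (suc N) a n (below , above) A≤a a+n≤A+N with A ℤP.<? a
  ... | yes A<a =
    trans (+-cong (below A A<a)
                  (sumFrom-shrink f (A +ℤ 1ℤ) N a n (below , above) (<⇒+1≤ A<a)
                                  (PE.subst (a +ℤ + n ≤_) (PE.sym ([a+1]+n≡a+suc[n] A N)) a+n≤A+N)))
          (+-identityˡ _)
  ... | no A≮a with ℤP.≤-antisym A≤a (ℤP.≮⇒≥ A≮a)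
  ... | PE.refl =
    sumFrom-truncate f A n (suc N) above (ℤP.drop‿+≤+ (+-cancelˡ-≤ A a+n≤A+N))

  sumFrom-supported : ∀ f a n a′ n′ → Supported f a n → Supported f a′ n′ →
                      sumFrom f a n ≈ sumFrom f a′ n′
  sumFrom-supported f a n a′ n′ s s′ =
    trans (sym (viaHull a n s (ℤP.i⊓j≤i a a′) (ℤP.i≤i⊔j _ _)))
          (viaHull a′ n′ s′ (ℤP.i⊓j≤j a a′) (ℤP.i≤j⊔i _ _))
    where
    A = a ℤ.⊓ a′
    M = (a +ℤ + n) ℤ.⊔ (a′ +ℤ + n′)
    viaHull : ∀ b m → Supported f b m → A ≤ b → b +ℤ + m ≤ M → sumFrom f A (clip (M -ℤ A)) ≈ sumFrom f b m
    viaHull b m s A≤b b+m≤M = sumFrom-shrink f A _ b m s A≤b (ℤP.≤-trans b+m≤M (ℤP.≤-reflexive (PE.sym hull)))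
      where
      A+M-A≡M : ∀ A M → A +ℤ (M -ℤ A) ≡ M
      A+M-A≡M = solve-∀
      hull : A +ℤ + clip (M -ℤ A) ≡ M
      hull = PE.trans (PE.cong (A +ℤ_) (+clip (ℤP.i≤j⇒0≤j-i (ℤP.≤-trans A≤b (ℤP.≤-trans (ℤP.i≤i+j b (+ m)) b+m≤M)))))
                      (A+M-A≡M A M)

  sumFrom-single : ∀ f p → (∀ i → i < p → f i ≈ 0#) → (∀ i → p < i → f i ≈ 0#) →
                   ∀ a n → Supported f a n → sumFrom f a n ≈ f p
  sumFrom-single f p below above a n s =
    trans (sumFrom-supported f a n p 1 s (below , λ i q → above i (+1≤⇒< q))) (+-identityʳ _)

  sumFrom-+ : ∀ f g a n → sumFrom (λ i → f i +K g i) a n ≈ sumFrom f a n +K sumFrom g a n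
  sumFrom-+ f g a zero = sym (+-identityˡ 0#)
  sumFrom-+ f g a (suc n) = trans (+-cong refl (sumFrom-+ f g (a +ℤ 1ℤ) n)) (+-interchange _ _ _ _)

  sumFrom-*ˡ : ∀ x f a n → x *K sumFrom f a n ≈ sumFrom (λ i → x *K f i) a n
  sumFrom-*ˡ x f a zero = zeroʳ x
  sumFrom-*ˡ x f a (suc n) = trans (distribˡ x (f a) _) (+-cong refl (sumFrom-*ˡ x f (a +ℤ 1ℤ) n))

  sumFrom-*ʳ : ∀ x f a n → sumFrom f a n *K x ≈ sumFrom (λ i → f i *K x) a n
  sumFrom-*ʳ x f a n = trans (*-comm _ x) (trans (sumFrom-*ˡ x f a n) (sumFrom-cong a n (λ i → *-comm x (f i))))

  sumFrom-swap : ∀ (g : ℤ → ℤ → Carrier) a n b m →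
    sumFrom (λ i → sumFrom (g i) b m) a n ≈ sumFrom (λ j → sumFrom (λ i → g i j) a n) b m
  sumFrom-swap g a zero b m = sym (sumFrom-zero _ b m (λ _ _ → refl))
  sumFrom-swap g a (suc n) b m = trans (+-cong refl (sumFrom-swap g (a +ℤ 1ℤ) n b m))
    (sym (sumFrom-+ (g a) (λ j → sumFrom (λ i → g i j) (a +ℤ 1ℤ) n) b m))

  sumFrom-snoc : ∀ f a n → sumFrom f a (suc n) ≈ sumFrom f a n +K f (a +ℤ + n)
  sumFrom-snoc f a zero =
    trans (+-identityʳ _) (trans (reflexive (PE.cong f (PE.sym (ℤP.+-identityʳ a)))) (sym (+-identityˡ _)))
  sumFrom-snoc f a (suc n) = trans (+-cong refl (sumFrom-snoc f (a +ℤ 1ℤ) n))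
    (trans (sym (+-assoc _ _ _)) (+-cong refl (reflexive (PE.cong f ([a+1]+n≡a+suc[n] a n)))))

  sumFrom-translate : ∀ f a n s → sumFrom f a n ≈ sumFrom (λ i → f (i +ℤ s)) (a -ℤ s) n
  sumFrom-translate f a zero s = refl
  sumFrom-translate f a (suc n) s =
    +-cong (reflexive (PE.cong f (a≡a-s+s a s)))
           (trans (sumFrom-translate f (a +ℤ 1ℤ) n s)
                  (reflexive (PE.cong (λ b → sumFrom (λ i → f (i +ℤ s)) b n) (a+1-s≡a-s+1 a s))))
    where
    a≡a-s+s : ∀ a s → a ≡ (a -ℤ s) +ℤ s
    a≡a-s+s = solve-∀
    a+1-s≡a-s+1 : ∀ a s → (a +ℤ 1ℤ) -ℤ s ≡ (a -ℤ s) +ℤ 1ℤ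
    a+1-s≡a-s+1 = solve-∀

  sumFrom-reflect : ∀ f a n s → sumFrom f a n ≈ sumFrom (λ j → f (s -ℤ j)) (s -ℤ (a +ℤ + n) +ℤ 1ℤ) n
  sumFrom-reflect f a zero s = refl
  sumFrom-reflect f a (suc n) s = begin
      f a +K sumFrom f (a +ℤ 1ℤ) n
    ≈⟨ +-cong refl (sumFrom-reflect f (a +ℤ 1ℤ) n s) ⟩
      f a +K sumFrom g (s -ℤ ((a +ℤ 1ℤ) +ℤ + n) +ℤ 1ℤ) n
    ≡⟨ PE.cong (λ b → f a +K sumFrom g (s -ℤ b +ℤ 1ℤ) n) ([a+1]+n≡a+suc[n] a n) ⟩
      f a +K sumFrom g b n
    ≈⟨ +-comm _ _ ⟩
      sumFrom g b n +K f a
    ≡⟨ PE.cong (λ i → sumFrom g b n +K f i) (PE.sym reflected) ⟩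
      sumFrom g b n +K g (b +ℤ + n)
    ≈⟨ sym (sumFrom-snoc g b n) ⟩
      sumFrom g b (suc n) ∎
    where
    g = λ j → f (s -ℤ j)
    b = s -ℤ (a +ℤ + suc n) +ℤ 1ℤ
    identity : ∀ s a m → s -ℤ ((s -ℤ (a +ℤ (1ℤ +ℤ m)) +ℤ 1ℤ) +ℤ m) ≡ a
    identity = solve-∀
    reflected : s -ℤ (b +ℤ + n) ≡ a
    reflected = PE.trans (PE.cong (λ m → s -ℤ ((s -ℤ (a +ℤ m) +ℤ 1ℤ) +ℤ + n)) (ℤP.pos-+ 1 n)) (identity s a (+ n))

  record Deg≤ (m : ℤ) (x : LS) : Set ℓ where
    constructor deg≤
    field vanishAbove : ∀ k → m < k → coeff x k ≈ 0#
  open Deg≤ public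

  deg≤-bound : ∀ x → Deg≤ (bound x) x
  deg≤-bound x = deg≤ (vanish x)

  Deg≤-weaken : ∀ {m m′ x} → m ≤ m′ → Deg≤ m x → Deg≤ m′ x
  Deg≤-weaken m≤m′ (deg≤ h) = deg≤ (λ k m′<k → h k (ℤP.≤-<-trans m≤m′ m′<k))

  coeff-mkLS : ∀ d f k → (∀ k → d < k → f k ≈ 0#) → coeff (mkLS d f) k ≈ f k
  coeff-mkLS d f k h with k ℤP.≤? d
  ... | yes _ = refl
  ... | no k≰d = sym (h k (ℤP.≰⇒> k≰d))

  coeff-mkLS-≤ : ∀ d f k → k ≤ d → coeff (mkLS d f) k ≈ f k
  coeff-mkLS-≤ d f k k≤d with k ℤP.≤? d
  ... | yes _ = refl
  ... | no k≰d = ⊥-elim (k≰d k≤d)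

  coeff-0L : ∀ k → coeff 0L k ≈ 0#
  coeff-0L k = coeff-mkLS _ _ k (λ _ _ → refl)

  coeff-+L : ∀ x y k → coeff (x +L y) k ≈ coeff x k +K coeff y k
  coeff-+L x y k = coeff-mkLS _ _ k (λ j p →
    trans (+-cong (vanish x j (ℤP.≤-<-trans (ℤP.i≤i⊔j _ _) p)) (vanish y j (ℤP.≤-<-trans (ℤP.i≤j⊔i _ _) p)))
          (+-identityˡ 0#))

  coeff--L : ∀ x k → coeff (-L x) k ≈ -K coeff x k
  coeff--L x k = coeff-mkLS _ _ k (λ j p → trans (-‿cong (vanish x j p)) KP.-0#≈0#)

  coeff-sub : ∀ x y k → coeff (x -L y) k ≈ coeff x k +K (-K coeff y k)
  coeff-sub x y k = trans (coeff-+L x (-L y) k) (+-cong refl (coeff--L y k))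

  convolution : LS → LS → ℤ → ℤ → Carrier
  convolution x y k i = coeff x i *K coeff y (k -ℤ i)

  convolution-supported : ∀ {X Y x y} → Deg≤ X x → Deg≤ Y y → ∀ k →
    Supported (convolution x y k) (k -ℤ Y) (clip (X +ℤ Y -ℤ k +ℤ 1ℤ))
  convolution-supported {X} {Y} (deg≤ hx) (deg≤ hy) k =
      (λ i i<k-Y → trans (*-cong refl (hy (k -ℤ i) (<-by-difference (k-i-Y≡k-Y-i i k Y) i<k-Y))) (zeroʳ _))
    , (λ i end≤i → trans (*-cong (hx i (+1≤⇒< (ℤP.≤-trans (ℤP.≤-reflexive (X+1≡k-Y+len X Y k))
                     (ℤP.≤-trans (ℤP.+-monoʳ-≤ (k -ℤ Y) (≤+clip _)) end≤i)))) refl) (zeroˡ _))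
    where
    k-i-Y≡k-Y-i : ∀ i k Y → (k -ℤ i) -ℤ Y ≡ (k -ℤ Y) -ℤ i
    k-i-Y≡k-Y-i = solve-∀
    X+1≡k-Y+len : ∀ X Y k → X +ℤ 1ℤ ≡ (k -ℤ Y) +ℤ (X +ℤ Y -ℤ k +ℤ 1ℤ)
    X+1≡k-Y+len = solve-∀

  coeff-*L : ∀ x y k a n → Supported (convolution x y k) a n → coeff (x *L y) k ≈ sumFrom (convolution x y k) a n
  coeff-*L x y k a n s with k ℤP.≤? (bound x +ℤ bound y)
  ... | yes _ = sumFrom-supported (convolution x y k) _ _ a n (convolution-supported (deg≤-bound x) (deg≤-bound y) k) s
  ... | no k≰X+Y = sym (sumFrom-zero _ a n (λ i _ → vanishing i))
    where
    k-i-Y≡k-[i+Y] : ∀ k i Y → (k -ℤ i) -ℤ Y ≡ k -ℤ (i +ℤ Y)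
    k-i-Y≡k-[i+Y] = solve-∀
    vanishing : ∀ i → convolution x y k i ≈ 0#
    vanishing i with i ℤP.≤? bound x
    ... | yes i≤X = trans (*-cong refl (vanish y _ (<-by-difference (k-i-Y≡k-[i+Y] k i (bound y))
                      (ℤP.≤-<-trans (ℤP.+-monoˡ-≤ (bound y) i≤X) (ℤP.≰⇒> k≰X+Y))))) (zeroʳ _)
    ... | no i≰X = trans (*-cong (vanish x i (ℤP.≰⇒> i≰X)) refl) (zeroˡ _)

  coeff-*L-window : ∀ {X Y x y} → Deg≤ X x → Deg≤ Y y → ∀ k →
    coeff (x *L y) k ≈ sumFrom (convolution x y k) (k -ℤ Y) (clip (X +ℤ Y -ℤ k +ℤ 1ℤ))
  coeff-*L-window {x = x} {y} hx hy k = coeff-*L x y k _ _ (convolution-supported hx hy k)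

  Deg≤-*L : ∀ {X Y x y} → Deg≤ X x → Deg≤ Y y → Deg≤ (X +ℤ Y) (x *L y)
  Deg≤-*L {X} {Y} {x} {y} hx hy = deg≤ λ k X+Y<k →
    trans (coeff-*L-window hx hy k)
          (reflexive (PE.cong (sumFrom (convolution x y k) (k -ℤ Y))
                 (clip-nonpos (ℤP.≤-trans (ℤP.≤-reflexive (length≡ X Y k)) (ℤP.i≤j⇒i-j≤0 (<⇒+1≤ X+Y<k))))))
    where
    length≡ : ∀ X Y k → X +ℤ Y -ℤ k +ℤ 1ℤ ≡ (X +ℤ Y +ℤ 1ℤ) -ℤ k
    length≡ = solve-∀

  coeff-*L-top : ∀ {X Y x y} → Deg≤ X x → Deg≤ Y y → coeff (x *L y) (X +ℤ Y) ≈ coeff x X *K coeff y Y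
  coeff-*L-top {X} {Y} {x} {y} hx hy =
    trans (coeff-*L-window hx hy (X +ℤ Y))
          (trans (sumFrom-single _ X below above _ _ (convolution-supported hx hy (X +ℤ Y)))
                 (*-cong refl (reflexive (PE.cong (coeff y) (X+Y-X≡Y X Y)))))
    where
    X+Y-X≡Y : ∀ X Y → (X +ℤ Y) -ℤ X ≡ Y
    X+Y-X≡Y = solve-∀
    shift : ∀ i X Y → (X +ℤ Y -ℤ i) -ℤ Y ≡ X -ℤ i
    shift = solve-∀
    below : ∀ i → i < X → convolution x y (X +ℤ Y) i ≈ 0#
    below i i<X = trans (*-cong refl (vanishAbove hy _ (<-by-difference (shift i X Y) i<X))) (zeroʳ _)
    above : ∀ i → X < i → convolution x y (X +ℤ Y) i ≈ 0#
    above i X<i = trans (*-cong (vanishAbove hx i X<i) refl) (zeroˡ _)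

  -- The ring of Laurent series

  -- ≈L wrapped in a record, so that both series can be inferred from a proof
  record _≋_ (x y : LS) : Set ℓ where
    constructor coeffwise
    field ≋⇒≈L : x ≈L y
  open _≋_ public
  infix 4 _≋_

  ≋-isEquivalence : IsEquivalence _≋_
  ≋-isEquivalence = record
    { refl  = coeffwise (λ k → refl)
    ; sym   = λ p → coeffwise (λ k → sym (≋⇒≈L p k))
    ; trans = λ p q → coeffwise (λ k → trans (≋⇒≈L p k) (≋⇒≈L q k))
    }

  Deg≤-cong : ∀ {m x y} → x ≋ y → Deg≤ m x → Deg≤ m y
  Deg≤-cong (coeffwise x≈y) (deg≤ h) = deg≤ (λ k m<k → trans (sym (x≈y k)) (h k m<k))

  +L-cong : ∀ {x x′ y y′} → x ≋ x′ → y ≋ y′ → x +L y ≋ x′ +L y′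
  +L-cong {x} {x′} {y} {y′} (coeffwise p) (coeffwise q) = coeffwise λ k →
    trans (coeff-+L x y k) (trans (+-cong (p k) (q k)) (sym (coeff-+L x′ y′ k)))

  -L-cong : ∀ {x x′} → x ≋ x′ → -L x ≋ -L x′
  -L-cong {x} {x′} (coeffwise p) = coeffwise λ k → trans (coeff--L x k) (trans (-‿cong (p k)) (sym (coeff--L x′ k)))

  +L-comm : ∀ x y → x +L y ≋ y +L x
  +L-comm x y = coeffwise λ k → trans (coeff-+L x y k) (trans (+-comm _ _) (sym (coeff-+L y x k)))

  +L-assoc : ∀ x y z → (x +L y) +L z ≋ x +L (y +L z)
  +L-assoc x y z = coeffwise λ k → begin
    coeff ((x +L y) +L z) k             ≈⟨ coeff-+L (x +L y) z k ⟩
    coeff (x +L y) k +K coeff z k       ≈⟨ +-cong (coeff-+L x y k) refl ⟩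
    (coeff x k +K coeff y k) +K coeff z k ≈⟨ +-assoc _ _ _ ⟩
    coeff x k +K (coeff y k +K coeff z k) ≈⟨ +-cong refl (coeff-+L y z k) ⟨
    coeff x k +K coeff (y +L z) k       ≈⟨ coeff-+L x (y +L z) k ⟨
    coeff (x +L (y +L z)) k             ∎

  +L-identityˡ : ∀ x → 0L +L x ≋ x
  +L-identityˡ x = coeffwise λ k → trans (coeff-+L 0L x k) (trans (+-cong (coeff-0L k) refl) (+-identityˡ _))

  +L-identityʳ : ∀ x → x +L 0L ≋ x
  +L-identityʳ x = coeffwise λ k → trans (≋⇒≈L (+L-comm x 0L) k) (≋⇒≈L (+L-identityˡ x) k)

  -L-inverseʳ : ∀ x → x +L (-L x) ≋ 0L
  -L-inverseʳ x = coeffwise λ k →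
    trans (coeff-sub x x k) (trans (-‿inverseʳ _) (sym (coeff-0L k)))

  -L-inverseˡ : ∀ x → (-L x) +L x ≋ 0L
  -L-inverseˡ x = coeffwise λ k → trans (≋⇒≈L (+L-comm (-L x) x) k) (≋⇒≈L (-L-inverseʳ x) k)

  *L-cong : ∀ {x x′ y y′} → x ≋ x′ → y ≋ y′ → x *L y ≋ x′ *L y′
  *L-cong {x} {x′} {y} {y′} (coeffwise p) (coeffwise q) = coeffwise λ k →
    trans (coeff-*L-window (deg≤-bound x) (deg≤-bound y) k)
          (trans (sumFrom-cong (lowest k) (len k) (termwise k))
                 (sym (coeff-*L x′ y′ k (lowest k) (len k) (supported k))))
    where
    lowest : ℤ → ℤ
    lowest k = k -ℤ bound y
    len : ℤ → ℕ
    len k = clip (bound x +ℤ bound y -ℤ k +ℤ 1ℤ)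
    termwise : ∀ k i → convolution x y k i ≈ convolution x′ y′ k i
    termwise k i = *-cong (p i) (q (k -ℤ i))
    supported : ∀ k → Supported (convolution x′ y′ k) (lowest k) (len k)
    supported k with convolution-supported (deg≤-bound x) (deg≤-bound y) k
    ... | below , above = (λ i r → trans (sym (termwise k i)) (below i r))
                        , (λ i r → trans (sym (termwise k i)) (above i r))

  Supported-reflect : ∀ {f a n} s → Supported f a n → Supported (λ j → f (s -ℤ j)) (s -ℤ (a +ℤ + n) +ℤ 1ℤ) n
  Supported-reflect {f} {a} {n} s (below , above) =
      (λ j j<b → above (s -ℤ j) (≤-by-difference (left s a (+ n) j) (<⇒+1≤ j<b)))
    , (λ j b+n≤j → below (s -ℤ j) (+1≤⇒< (≤-by-difference (right s a (+ n) j) b+n≤j)))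
    where
    left : ∀ s a n j → (s -ℤ j) -ℤ (a +ℤ n) ≡ (s -ℤ (a +ℤ n) +ℤ 1ℤ) -ℤ (j +ℤ 1ℤ)
    left = solve-∀
    right : ∀ s a n j → a -ℤ ((s -ℤ j) +ℤ 1ℤ) ≡ j -ℤ (s -ℤ (a +ℤ n) +ℤ 1ℤ +ℤ n)
    right = solve-∀

  *L-comm : ∀ x y → x *L y ≋ y *L x
  *L-comm x y = coeffwise λ k →
    trans (coeff-*L-window (deg≤-bound x) (deg≤-bound y) k)
    (trans (sumFrom-reflect (convolution x y k) (k -ℤ bound y) (len k) k)
    (trans (sumFrom-cong _ (len k) (reflected k))
           (sym (coeff-*L y x k _ (len k) (supported k)))))
    where
    len : ℤ → ℕ
    len k = clip (bound x +ℤ bound y -ℤ k +ℤ 1ℤ)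
    k-[k-j]≡j : ∀ k j → k -ℤ (k -ℤ j) ≡ j
    k-[k-j]≡j = solve-∀
    reflected : ∀ k j → convolution x y k (k -ℤ j) ≈ convolution y x k j
    reflected k j = trans (*-comm _ _) (*-cong (reflexive (PE.cong (coeff y) (k-[k-j]≡j k j))) refl)
    supported : ∀ k → Supported (convolution y x k) (k -ℤ ((k -ℤ bound y) +ℤ + len k) +ℤ 1ℤ) (len k)
    supported k with Supported-reflect k (convolution-supported (deg≤-bound x) (deg≤-bound y) k)
    ... | below , above = (λ j r → trans (sym (reflected k j)) (below j r))
                        , (λ j r → trans (sym (reflected k j)) (above j r))

  *L-distribˡ : ∀ x y z → x *L (y +L z) ≋ (x *L y) +L (x *L z)
  *L-distribˡ x y z = coeffwise λ k →
    trans (coeff-*L-window (deg≤-bound x) (deg≤-bound (y +L z)) k)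
    (trans (sumFrom-cong _ (len k) (termwise k))
    (trans (sumFrom-+ (convolution x y k) (convolution x z k) _ (len k))
           (sym (trans (coeff-+L (x *L y) (x *L z) k)
                       (+-cong (coeff-*L-window (deg≤-bound x) (Deg≤-weaken (ℤP.i≤i⊔j _ _) (deg≤-bound y)) k)
                               (coeff-*L-window (deg≤-bound x) (Deg≤-weaken (ℤP.i≤j⊔i _ _) (deg≤-bound z)) k))))))
    where
    len : ℤ → ℕ
    len k = clip (bound x +ℤ (bound y ℤ.⊔ bound z) -ℤ k +ℤ 1ℤ)
    termwise : ∀ k i → convolution x (y +L z) k i ≈ convolution x y k i +K convolution x z k i
    termwise k i = trans (*-cong refl (coeff-+L y z (k -ℤ i))) (distribˡ _ _ _)

  indicator : ℤ → ℤ → Carrier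
  indicator d k = if ⌊ k ℤ.≟ d ⌋ then 1# else 0#

  monomial : ℤ → LS
  monomial d = mkLS d (indicator d)

  coeff-monomial-≡ : ∀ d → coeff (monomial d) d ≈ 1#
  coeff-monomial-≡ d = trans (coeff-mkLS-≤ d (indicator d) d ℤP.≤-refl) (diagonal (d ℤ.≟ d))
    where
    diagonal : ∀ (q : Dec (d ≡ d)) → (if ⌊ q ⌋ then 1# else 0#) ≈ 1#
    diagonal (yes _) = refl
    diagonal (no d≢d) = ⊥-elim (d≢d PE.refl)

  coeff-monomial-≢ : ∀ d k → k ≢ d → coeff (monomial d) k ≈ 0#
  coeff-monomial-≢ d k k≢d with k ℤP.≤? d
  ... | no _ = refl
  ... | yes _ with k ℤ.≟ d
  ... | yes k≡d = ⊥-elim (k≢d k≡d)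
  ... | no _ = refl

  Deg≤-monomial : ∀ d → Deg≤ d (monomial d)
  Deg≤-monomial d = deg≤ (λ k d<k → coeff-monomial-≢ d k (λ k≡d → ℤP.<⇒≢ d<k (PE.sym k≡d)))

  coeff-monomial-*L : ∀ d x k → coeff (monomial d *L x) k ≈ coeff x (k -ℤ d)
  coeff-monomial-*L d x k =
    trans (coeff-*L-window (Deg≤-monomial d) (deg≤-bound x) k)
    (trans (sumFrom-single _ d
              (λ i i<d → trans (*-cong (coeff-monomial-≢ d i (ℤP.<⇒≢ i<d)) refl) (zeroˡ _))
              (λ i d<i → trans (*-cong (vanishAbove (Deg≤-monomial d) i d<i) refl) (zeroˡ _)) _ _
              (convolution-supported (Deg≤-monomial d) (deg≤-bound x) k))
           (trans (*-cong (coeff-monomial-≡ d) refl) (*-identityˡ _)))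

  *L-identityˡ : ∀ x → 1L *L x ≋ x
  *L-identityˡ x = coeffwise λ k → trans (coeff-monomial-*L 0ℤ x k) (reflexive (PE.cong (coeff x) (ℤP.+-identityʳ k)))

  *L-identityʳ : ∀ x → x *L 1L ≋ x
  *L-identityʳ x = coeffwise λ k → trans (≋⇒≈L (*L-comm x 1L) k) (≋⇒≈L (*L-identityˡ x) k)

  *L-distribʳ : ∀ x y z → (y +L z) *L x ≋ (y *L x) +L (z *L x)
  *L-distribʳ x y z = coeffwise λ k →
    trans (≋⇒≈L (*L-comm (y +L z) x) k)
    (trans (≋⇒≈L (*L-distribˡ x y z) k) (≋⇒≈L (+L-cong (*L-comm x y) (*L-comm x z)) k))

  -- Both sides are the double sum of x_j y_{i-j} z_{k-i}, summed in the two possible orders.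
  *L-assoc : ∀ x y z → (x *L y) *L z ≋ x *L (y *L z)
  *L-assoc x y z = coeffwise sameDoubleSum
    where
    X = bound x
    Y = bound y
    Z = bound z
    sameDoubleSum : ∀ k → coeff ((x *L y) *L z) k ≈ coeff (x *L (y *L z)) k
    sameDoubleSum k = begin
        coeff ((x *L y) *L z) k
      ≈⟨ coeff-*L-window (Deg≤-*L (deg≤-bound x) (deg≤-bound y)) (deg≤-bound z) k ⟩
        sumFrom (convolution (x *L y) z k) (k -ℤ Z) N₁
      ≈⟨ sumFrom-cong (k -ℤ Z) N₁ outer ⟩
        sumFrom (λ i → sumFrom (convolution x y i) (k -ℤ (Y +ℤ Z)) N₂ *K coeff z (k -ℤ i)) (k -ℤ Z) N₁
      ≈⟨ sumFrom-cong (k -ℤ Z) N₁ (λ i → sumFrom-*ʳ (coeff z (k -ℤ i)) (convolution x y i) _ N₂) ⟩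
        sumFrom (λ i → sumFrom (λ j → convolution x y i j *K coeff z (k -ℤ i)) (k -ℤ (Y +ℤ Z)) N₂) (k -ℤ Z) N₁
      ≈⟨ sumFrom-swap (λ i j → convolution x y i j *K coeff z (k -ℤ i)) (k -ℤ Z) N₁ _ N₂ ⟩
        sumFrom (λ j → sumFrom (λ i → convolution x y i j *K coeff z (k -ℤ i)) (k -ℤ Z) N₁) (k -ℤ (Y +ℤ Z)) N₂
      ≈⟨ sumFrom-cong (k -ℤ (Y +ℤ Z)) N₂ inner ⟩
        sumFrom (convolution x (y *L z) k) (k -ℤ (Y +ℤ Z)) N₂
      ≈⟨ coeff-*L-window (deg≤-bound x) (Deg≤-*L (deg≤-bound y) (deg≤-bound z)) k ⟨
        coeff (x *L (y *L z)) k ∎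
      where
      N₁ = clip (X +ℤ Y +ℤ Z -ℤ k +ℤ 1ℤ)
      N₂ = clip (X +ℤ (Y +ℤ Z) -ℤ k +ℤ 1ℤ)
      k-i-Z≡k-Z-i : ∀ i k Z → (k -ℤ i) -ℤ Z ≡ (k -ℤ Z) -ℤ i
      k-i-Z≡k-Z-i = solve-∀
      i-j-Y : ∀ i j k Y Z → (i -ℤ j) -ℤ Y ≡ ((k -ℤ (Y +ℤ Z)) +ℤ i) -ℤ (j +ℤ (k -ℤ Z))
      i-j-Y = solve-∀
      k-j-l-Z : ∀ l j k Z → ((k -ℤ j) -ℤ l) -ℤ Z ≡ ((k -ℤ Z) -ℤ j) -ℤ l
      k-j-l-Z = solve-∀
      l-Y-1 : ∀ l j k X Y Z → l -ℤ (Y +ℤ 1ℤ) ≡ (X +ℤ l) -ℤ (j +ℤ ((k -ℤ Z -ℤ j) +ℤ (X +ℤ Y +ℤ Z -ℤ k +ℤ 1ℤ)))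
      l-Y-1 = solve-∀
      l+j-j≡l : ∀ l j → (l +ℤ j) -ℤ j ≡ l
      l+j-j≡l = solve-∀
      k-[l+j] : ∀ l j k → k -ℤ (l +ℤ j) ≡ (k -ℤ j) -ℤ l
      k-[l+j] = solve-∀
      outer : ∀ i → convolution (x *L y) z k i ≈ sumFrom (convolution x y i) (k -ℤ (Y +ℤ Z)) N₂ *K coeff z (k -ℤ i)
      outer i with i ℤP.<? k -ℤ Z
      ... | yes i<k-Z = trans (*-cong refl zᵢ) (trans (zeroʳ _) (sym (trans (*-cong refl zᵢ) (zeroʳ _))))
        where zᵢ = vanish z (k -ℤ i) (<-by-difference (k-i-Z≡k-Z-i i k Z) i<k-Z)
      ... | no i≮k-Z = *-cong (coeff-*L x y i _ N₂
          ( (λ j j<lo → trans (*-cong refl (vanish y (i -ℤ j) (<-by-difference (i-j-Y i j k Y Z)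
                                                                (ℤP.+-mono-<-≤ j<lo (ℤP.≮⇒≥ i≮k-Z))))) (zeroʳ _))
          , (λ j hi≤j → trans (*-cong (vanish x j (+1≤⇒< (ℤP.≤-trans (ℤP.≤-reflexive (X+1≡ X (Y +ℤ Z) k))
                            (ℤP.≤-trans (ℤP.+-monoʳ-≤ (k -ℤ (Y +ℤ Z)) (≤+clip _)) hi≤j)))) refl) (zeroˡ _)))) refl
        where
        X+1≡ : ∀ X Y k → X +ℤ 1ℤ ≡ (k -ℤ Y) +ℤ (X +ℤ Y -ℤ k +ℤ 1ℤ)
        X+1≡ = solve-∀
      inner : ∀ j → sumFrom (λ i → convolution x y i j *K coeff z (k -ℤ i)) (k -ℤ Z) N₁ ≈ convolution x (y *L z) k j
      inner j = trans (sumFrom-cong (k -ℤ Z) N₁ (λ i → *-assoc _ _ _))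
                  (trans (sym (sumFrom-*ˡ (coeff x j) (λ i → coeff y (i -ℤ j) *K coeff z (k -ℤ i)) (k -ℤ Z) N₁))
                         (byDegree (j ℤP.≤? X)))
        where
        byDegree : Dec (j ≤ X) → coeff x j *K sumFrom (λ i → coeff y (i -ℤ j) *K coeff z (k -ℤ i)) (k -ℤ Z) N₁
                                   ≈ convolution x (y *L z) k j
        byDegree (no j≰X) = trans (*-cong xⱼ refl) (trans (zeroˡ _) (sym (trans (*-cong xⱼ refl) (zeroˡ _))))
          where xⱼ = vanish x j (ℤP.≰⇒> j≰X)
        byDegree (yes j≤X) = *-cong refl
          (trans (sumFrom-translate _ (k -ℤ Z) N₁ j)
          (trans (sumFrom-cong (k -ℤ Z -ℤ j) N₁ translated)
                 (sym (coeff-*L y z (k -ℤ j) (k -ℤ Z -ℤ j) N₁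
                   ( (λ l r → trans (*-cong refl (vanish z _ (<-by-difference (k-j-l-Z l j k Z) r))) (zeroʳ _))
                   , (λ l r → trans (*-cong (vanish y l (+1≤⇒< (≤-by-difference (l-Y-1 l j k X Y Z)
                         (ℤP.+-mono-≤ j≤X (ℤP.≤-trans (ℤP.+-monoʳ-≤ (k -ℤ Z -ℤ j) (≤+clip _)) r))))) refl)
                         (zeroˡ _)))))))
          where
          translated : ∀ l → coeff y ((l +ℤ j) -ℤ j) *K coeff z (k -ℤ (l +ℤ j)) ≈ convolution y z (k -ℤ j) l
          translated l = *-cong (reflexive (PE.cong (coeff y) (l+j-j≡l l j))) (reflexive (PE.cong (coeff z) (k-[l+j] l j k)))

  laurentRing : CommutativeRing (c Level.⊔ ℓ) ℓ
  laurentRing = record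
    { _≈_ = _≋_ ; _+_ = _+L_ ; _*_ = _*L_ ; -_ = -L_ ; 0# = 0L ; 1# = 1L
    ; isCommutativeRing = record
      { isRing = record
        { +-isAbelianGroup = record
          { isGroup = record
            { isMonoid = record
              { isSemigroup = record
                { isMagma = record { isEquivalence = ≋-isEquivalence ; ∙-cong = +L-cong }
                ; assoc = +L-assoc }
              ; identity = +L-identityˡ , +L-identityʳ }
            ; inverse = -L-inverseˡ , -L-inverseʳ
            ; ⁻¹-cong = -L-cong }
          ; comm = +L-comm }
        ; *-cong = *L-cong
        ; *-assoc = *L-assoc
        ; *-identity = *L-identityˡ , *L-identityʳ
        ; distrib = *L-distribˡ , *L-distribʳ }
      ; *-comm = *L-comm }
    }

module LaurentDegree {c ℓ : Level} (K : Field c ℓ) where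
  open LaurentRing K public
  open Field K using (Carrier; _≈_; 0#; 1#; refl; reflexive; sym; trans;
    +-cong; +-identityˡ; +-identityʳ; *-cong; *-identityˡ; -‿cong; -‿inverseʳ)
    renaming (_*_ to _*K_; -_ to -K_)
  module L = CommutativeRing laurentRing
  module LP = RingProperties L.ring
  open SetoidReasoning L.setoid

  Deg≤-0L : ∀ m → Deg≤ m 0L
  Deg≤-0L m = deg≤ (λ k _ → coeff-0L k)

  Deg≤-+L : ∀ {m x y} → Deg≤ m x → Deg≤ m y → Deg≤ m (x +L y)
  Deg≤-+L {x = x} {y} (deg≤ hx) (deg≤ hy) = deg≤ λ k m<k →
    trans (coeff-+L x y k) (trans (+-cong (hx k m<k) (hy k m<k)) (+-identityˡ 0#))

  Deg≤--L : ∀ {m x} → Deg≤ m x → Deg≤ m (-L x)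
  Deg≤--L {x = x} (deg≤ hx) = deg≤ λ k m<k → trans (coeff--L x k) (trans (-‿cong (hx k m<k)) KP.-0#≈0#)

  Deg≤-sub : ∀ {m x y} → Deg≤ m x → Deg≤ m y → Deg≤ m (x -L y)
  Deg≤-sub hx hy = Deg≤-+L hx (Deg≤--L hy)

  coeff-≈-above : ∀ {m} x y → Deg≤ m (x -L y) → ∀ k → m < k → coeff x k ≈ coeff y k
  coeff-≈-above x y (deg≤ h) k m<k =
    KP.x∙y⁻¹≈ε⇒x≈y _ _ (trans (sym (coeff-sub x y k)) (h k m<k))

  record Leading (m : ℤ) (a : Carrier) (x : LS) : Set ℓ where
    constructor leading
    field
      leadingDeg≤  : Deg≤ m x
      leadingCoeff : coeff x m ≈ a
  open Leading public

  Leading-cong : ∀ {m a x y} → x ≋ y → Leading m a x → Leading m a y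
  Leading-cong x≋y (leading hx cx) = leading (Deg≤-cong x≋y hx) (trans (sym (≋⇒≈L x≋y _)) cx)

  Leading-coeff-cong : ∀ {m a a′ x} → a ≈ a′ → Leading m a x → Leading m a′ x
  Leading-coeff-cong a≈a′ (leading hx cx) = leading hx (trans cx a≈a′)

  Leading-monomial : ∀ d → Leading d 1# (monomial d)
  Leading-monomial d = leading (Deg≤-monomial d) (coeff-monomial-≡ d)

  Leading-*L : ∀ {m n a b x y} → Leading m a x → Leading n b y → Leading (m +ℤ n) (a *K b) (x *L y)
  Leading-*L (leading hx cx) (leading hy cy) = leading (Deg≤-*L hx hy) (trans (coeff-*L-top hx hy) (*-cong cx cy))

  Leading--L : ∀ {m a x} → Leading m a x → Leading m (-K a) (-L x)
  Leading--L {m} {x = x} (leading hx cx) = leading (Deg≤--L hx) (trans (coeff--L x m) (-‿cong cx))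

  Leading-+L-lower : ∀ {m m′ a x y} → Leading m a x → Deg≤ m′ y → m′ < m → Leading m a (x +L y)
  Leading-+L-lower {m} {a = a} {x} {y} (leading hx cx) hy m′<m =
    leading (Deg≤-+L hx (Deg≤-weaken (ℤP.<⇒≤ m′<m) hy))
            (trans (coeff-+L x y m) (trans (+-cong cx (vanishAbove hy m m′<m)) (+-identityʳ a)))

  -- Inverses

  open GeometricSum L.ring using (geometric; geometric-telescope)
  open RawSemiringDefinitions (Semiring.rawSemiring L.semiring) using (_^_)
  open CommutativeSemigroupProperties (CommutativeMonoid.commutativeSemigroup L.+-commutativeMonoid)
    public using () renaming (xy∙z≈xz∙y to +L-swapʳ; interchange to +L-interchange)

  Deg≤-^ : ∀ {u} → Deg≤ (-ℤ 1ℤ) u → ∀ n → Deg≤ (-ℤ + n) (u ^ n)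
  Deg≤-^ hu zero = Deg≤-monomial 0ℤ
  Deg≤-^ hu (suc n) = Deg≤-weaken (ℤP.≤-reflexive (-1-n≡-[1+n] n)) (Deg≤-*L hu (Deg≤-^ hu n))
    where
    -1-n≡-[1+n] : ∀ n → -ℤ 1ℤ +ℤ -ℤ + n ≡ -[1+ n ]
    -1-n≡-[1+n] zero = PE.refl
    -1-n≡-[1+n] (suc n) = PE.refl

  Deg≤-geometric : ∀ {u} → Deg≤ (-ℤ 1ℤ) u → ∀ N → Deg≤ 0ℤ (geometric u N)
  Deg≤-geometric hu zero = Deg≤-monomial 0ℤ
  Deg≤-geometric hu (suc N) =
    Deg≤-+L (Deg≤-geometric hu N) (Deg≤-weaken (-ℤ+n≤0 (suc N)) (Deg≤-^ hu (suc N)))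

  geometric-stable : ∀ {u} → Deg≤ (-ℤ 1ℤ) u → ∀ d M → Deg≤ -[1+ M ] (geometric u (d ℕ.+ M) -L geometric u M)
  geometric-stable {u} hu zero M = Deg≤-cong (L.sym (L.-‿inverseʳ (geometric u M))) (Deg≤-0L _)
  geometric-stable {u} hu (suc d) M =
    Deg≤-cong (L.sym (+L-swapʳ (geometric u (d ℕ.+ M)) (u ^ suc (d ℕ.+ M)) (-L geometric u M)))
              (Deg≤-+L (geometric-stable hu d M) (Deg≤-weaken (ℤ.-≤- (ℕP.m≤n+m M d)) (Deg≤-^ hu (suc (d ℕ.+ M)))))

  -- 1/(1 + z) = Σᵢ (-z)ⁱ; when deg z < 0 its coefficient of tᵏ (k ≤ 0) is already that of the partial sum up to i = -k.
  reciprocal1+ : LS → LS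
  reciprocal1+ z = mkLS 0ℤ (λ k → coeff (geometric (-L z) (clip (-ℤ k))) k)

  coeff-reciprocal1+ : ∀ {z} → Deg≤ (-ℤ 1ℤ) z → ∀ N k → -ℤ + N ≤ k →
                       coeff (reciprocal1+ z) k ≈ coeff (geometric (-L z) N) k
  coeff-reciprocal1+ {z} hz N k -N≤k with k ℤP.≤? 0ℤ
  ... | no k≰0 = sym (vanishAbove (Deg≤-geometric (Deg≤--L hz) N) k (ℤP.≰⇒> k≰0))
  ... | yes k≤0 = sym (PE.subst (λ N′ → coeff (G N′) k ≈ coeff (G M) k) (ℕP.m∸n+n≡m M≤N)
                                (coeff-≈-above (G (N ℕ.∸ M ℕ.+ M)) (G M) (geometric-stable (Deg≤--L hz) (N ℕ.∸ M) M) k -[1+M]<k))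
    where
    G = geometric (-L z)
    M = clip (-ℤ k)
    k≡-M : k ≡ -ℤ + M
    k≡-M = nonpos≡-clip k≤0
    M≤N : M ℕ.≤ N
    M≤N = ℤP.drop‿+≤+ (ℤP.neg-cancel-≤ (PE.subst (-ℤ + N ≤_) k≡-M -N≤k))
    -[1+M]<k : -[1+ M ] < k
    -[1+M]<k = PE.subst (-[1+ M ] <_) (PE.sym k≡-M) (ℤP.neg-mono-< (ℤ.+<+ (ℕP.n<1+n M)))

  *L-reciprocal1+ : ∀ {z} → Deg≤ (-ℤ 1ℤ) z → (1L +L z) *L reciprocal1+ z ≋ 1L
  *L-reciprocal1+ {z} hz = coeffwise λ k → atDegree k (k ℤP.≤? 0ℤ)
    where
    w = reciprocal1+ z
    Deg≤-1+z : Deg≤ 0ℤ (1L +L z)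
    Deg≤-1+z = Deg≤-+L (Deg≤-monomial 0ℤ) (Deg≤-weaken ℤ.-≤+ hz)
    atDegree : ∀ k → Dec (k ≤ 0ℤ) → coeff ((1L +L z) *L w) k ≈ coeff 1L k
    atDegree k (no k≰0) = trans (vanishAbove (Deg≤-*L Deg≤-1+z (deg≤-bound w)) k (ℤP.≰⇒> k≰0))
                                (sym (vanishAbove (Deg≤-monomial 0ℤ) k (ℤP.≰⇒> k≰0)))
    -- With N = -k:  (1 + z) w = (1 - (-z)ᴺ⁺¹) + (1 + z)(w - (1 - z + … + (-z)ᴺ)),
    -- and both (-z)ᴺ⁺¹ and w - (1 - z + … + (-z)ᴺ) have degree < k.
    atDegree k (yes k≤0) =
      trans (≋⇒≈L expand k)
      (trans (coeff-+L (1L -L P) ((1L +L z) *L D) k)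
      (trans (+-cong (trans (coeff-sub 1L P k) (trans (+-cong refl (trans (-‿cong Pₖ≈0) KP.-0#≈0#)) (+-identityʳ _)))
                     (vanishAbove (Deg≤-*L Deg≤-1+z Deg≤-D) k (ℤP.≤-<-trans (ℤP.≤-reflexive (ℤP.+-identityˡ _)) k-1<k)))
             (+-identityʳ _)))
      where
      N = clip (-ℤ k)
      k≡-N : k ≡ -ℤ + N
      k≡-N = nonpos≡-clip k≤0
      G = geometric (-L z) N
      P = (-L z) ^ suc N
      D = w -L G
      k-1<k : k -ℤ 1ℤ < k
      k-1<k = +1≤⇒< (ℤP.≤-reflexive (i-1+1≡i k))
      Deg≤-D : Deg≤ (k -ℤ 1ℤ) D
      Deg≤-D = deg≤ λ k′ k-1<k′ → trans (coeff-sub w G k′) (KP.x≈y⇒x∙y⁻¹≈ε (coeff-reciprocal1+ hz N k′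
                 (PE.subst (_≤ k′) k≡-N (ℤP.≤-trans (ℤP.≤-reflexive (PE.sym (i-1+1≡i k))) (<⇒+1≤ k-1<k′)))))
      Pₖ≈0 : coeff P k ≈ 0#
      Pₖ≈0 = vanishAbove (Deg≤-^ (Deg≤--L hz) (suc N)) k
               (PE.subst (-[1+ N ] <_) (PE.sym k≡-N) (ℤP.neg-mono-< (ℤ.+<+ (ℕP.n<1+n N))))
      expand : (1L +L z) *L w ≋ (1L -L P) +L ((1L +L z) *L D)
      expand = begin
        (1L +L z) *L w
          ≈⟨ *L-cong {1L +L z} L.refl (L.sym (L.trans (L.+-comm G D) (LP.//-rightDividesˡ G w))) ⟩
        (1L +L z) *L (G +L D)
          ≈⟨ L.distribˡ (1L +L z) G D ⟩
        ((1L +L z) *L G) +L ((1L +L z) *L D)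
          ≈⟨ +L-cong (L.trans (*L-cong (+L-cong (L.refl {1L}) (L.sym (LP.-‿involutive z))) (L.refl {G}))
                              (geometric-telescope (-L z) N))
                     (L.refl {(1L +L z) *L D}) ⟩
        (1L -L P) +L ((1L +L z) *L D) ∎

  inverse-unique : ∀ {y z w} → y *L z ≋ 1L → z *L w ≋ 1L → y ≋ w
  inverse-unique {y} {z} {w} yz≋1 zw≋1 = begin
    y                ≈⟨ L.*-identityʳ y ⟨
    y *L 1L          ≈⟨ *L-cong (L.refl {y}) zw≋1 ⟨
    y *L (z *L w)    ≈⟨ L.*-assoc y z w ⟨
    (y *L z) *L w    ≈⟨ *L-cong yz≋1 (L.refl {w}) ⟩
    1L *L w          ≈⟨ L.*-identityˡ w ⟩
    w                ∎

  Leading-0L : ∀ {m a} → Leading m a 0L → a ≈ 0#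
  Leading-0L {m} (leading _ c0) = trans (sym c0) (coeff-0L m)

  Leading-index : ∀ {m m′ a x} → m ≡ m′ → Leading m a x → Leading m′ a x
  Leading-index PE.refl h = h

  Leading-reciprocal1+ : ∀ {z} → Deg≤ (-ℤ 1ℤ) z → Leading 0ℤ 1# (reciprocal1+ z)
  Leading-reciprocal1+ hz = leading (deg≤-bound _) (trans (coeff-reciprocal1+ hz 0 0ℤ ℤP.≤-refl) (coeff-monomial-≡ 0ℤ))

  -- Writing z = tᵈ (1 + s) with deg s < 0 gives 1/z = t⁻ᵈ · 1/(1 + s).
  Leading-reciprocal : ∀ {d z y} → Leading d 1# z → y *L z ≋ 1L → Leading (-ℤ d) 1# y
  Leading-reciprocal {d} {z} {y} (leading hz cz) yz≋1 =
    Leading-cong (L.sym (inverse-unique {y} {z} yz≋1 z*z⁻¹≋1))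
      (Leading-index (ℤP.+-identityʳ (-ℤ d))
        (Leading-coeff-cong (*-identityˡ 1#) (Leading-*L (Leading-monomial (-ℤ d)) (Leading-reciprocal1+ Deg≤-s))))
    where
    t⁻ᵈ = monomial (-ℤ d)
    s = (t⁻ᵈ *L z) -L 1L
    0+--d≡d : ∀ d → 0ℤ -ℤ -ℤ d ≡ d
    0+--d≡d = solve-∀
    coeff-s : ∀ k → Dec (k ≡ 0ℤ) → -ℤ 1ℤ < k → coeff s k ≈ 0#
    coeff-s k (yes PE.refl) _ =
      trans (coeff-sub (t⁻ᵈ *L z) 1L 0ℤ)
            (trans (+-cong (trans (coeff-monomial-*L (-ℤ d) z 0ℤ) (trans (reflexive (PE.cong (coeff z) (0+--d≡d d))) cz))
                           (-‿cong (coeff-monomial-≡ 0ℤ)))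
                   (-‿inverseʳ 1#))
    coeff-s k (no k≢0) -1<k =
      trans (coeff-sub (t⁻ᵈ *L z) 1L k)
            (trans (+-cong (trans (coeff-monomial-*L (-ℤ d) z k)
                                  (vanishAbove hz _ (<-by-difference (k+d-d k d) (ℤP.≤∧≢⇒< (<⇒+1≤ -1<k) (k≢0 ∘ PE.sym)))))
                           (-‿cong (coeff-monomial-≢ 0ℤ k k≢0)))
                   (trans (+-cong refl KP.-0#≈0#) (+-identityʳ 0#)))
      where
      k+d-d : ∀ k d → (k -ℤ -ℤ d) -ℤ d ≡ k -ℤ 0ℤ
      k+d-d = solve-∀
    Deg≤-s : Deg≤ (-ℤ 1ℤ) s
    Deg≤-s = deg≤ λ k -1<k → coeff-s k (k ℤ.≟ 0ℤ) -1<k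
    z*z⁻¹≋1 : z *L (t⁻ᵈ *L reciprocal1+ s) ≋ 1L
    z*z⁻¹≋1 = begin
      z *L (t⁻ᵈ *L reciprocal1+ s)   ≈⟨ L.*-assoc z t⁻ᵈ (reciprocal1+ s) ⟨
      (z *L t⁻ᵈ) *L reciprocal1+ s   ≈⟨ *L-cong (L.*-comm z t⁻ᵈ) (L.refl {reciprocal1+ s}) ⟩
      (t⁻ᵈ *L z) *L reciprocal1+ s   ≈⟨ *L-cong t⁻ᵈz≋1+s (L.refl {reciprocal1+ s}) ⟩
      (1L +L s) *L reciprocal1+ s    ≈⟨ *L-reciprocal1+ Deg≤-s ⟩
      1L                             ∎
      where
      t⁻ᵈz≋1+s : t⁻ᵈ *L z ≋ 1L +L s
      t⁻ᵈz≋1+s = L.sym (L.trans (L.+-comm 1L s) (LP.//-rightDividesˡ 1L (t⁻ᵈ *L z)))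

module ContinuedFractionLemmas {c ℓ : Level} (K : Field c ℓ) where
  open LaurentDegree K public
  open Field K using (Carrier; _≈_; 0#; 1#; refl; sym; trans; +-cong; +-identityʳ; *-cong; *-identityˡ; -‿cong; -‿inverseʳ)
    renaming (-_ to -K_)

  PolyPart-unique : ∀ {a a′ x} → PolyPart a x → PolyPart a′ x → a ≋ a′
  PolyPart-unique {a} {a′} (below , above) (below′ , above′) = coeffwise λ k → byDegree k (k ℤP.<? 0ℤ)
    where
    byDegree : ∀ k → Dec (k < 0ℤ) → coeff a k ≈ coeff a′ k
    byDegree k (yes k<0) = trans (below k k<0) (sym (below′ k k<0))
    byDegree k (no k≮0) = trans (above k (ℤP.≮⇒≥ k≮0)) (sym (above′ k (ℤP.≮⇒≥ k≮0)))

  PolyPart-cong : ∀ {a x x′} → x ≋ x′ → PolyPart a x → PolyPart a x′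
  PolyPart-cong x≋x′ (below , above) = below , λ k 0≤k → trans (above k 0≤k) (≋⇒≈L x≋x′ k)

  PolyPart-perturb : ∀ {a x ε} → PolyPart a x → Deg≤ (-ℤ 1ℤ) ε → PolyPart a (x +L ε)
  PolyPart-perturb {x = x} {ε} (below , above) hε = below , λ k 0≤k →
    trans (above k 0≤k)
          (sym (trans (coeff-+L x ε k) (trans (+-cong refl (vanishAbove hε k (+1≤⇒< 0≤k))) (+-identityʳ _))))

  Deg≤-fractional : ∀ {a x} → PolyPart a x → Deg≤ (-ℤ 1ℤ) (x -L a)
  Deg≤-fractional {a} {x} (_ , above) = deg≤ λ k -1<k →
    trans (coeff-sub x a k) (trans (+-cong refl (-‿cong (above k (<⇒+1≤ -1<k)))) (-‿inverseʳ _))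

  PolyPart-0L : ∀ {x} → Deg≤ (-ℤ 1ℤ) x → PolyPart 0L x
  PolyPart-0L hx = (λ k _ → coeff-0L k)
                 , (λ k 0≤k → trans (coeff-0L k) (sym (vanishAbove hx k (+1≤⇒< 0≤k))))

  PQ-cong : ∀ n {x x′ p} → x ≋ x′ → PQ n x p → PQ n x′ p
  PQ-cong zero {p = p} x≋x′ (Level.lift pp) = Level.lift (PolyPart-cong {p} x≋x′ pp)
  PQ-cong (suc n) {x} {x′} x≋x′ (a , y , pp , inverse , rest) =
      a , y , PolyPart-cong {a} x≋x′ pp
    , ≋⇒≈L (L.trans (*L-cong (+L-cong (L.sym x≋x′) (L.refl { -L a})) (L.refl {y}))
                    (coeffwise {(x -L a) *L y} {1L} inverse))
    , rest

  record CompleteQuotient (x : LS) (A : ℕ → LS) : Set (c Level.⊔ ℓ) where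
    field
      x₁         : LS
      x₁-inverse : (x -L A 0) *L x₁ ≋ 1L
      x₁-hasCF   : HasCF x₁ (A ∘ suc)

  completeQuotient : ∀ {x A} → HasCF x A → CompleteQuotient x A
  completeQuotient {x} {A} hx with hx 1
  ... | a , x₁ , pp , inverse , _ = record
    { x₁ = x₁ ; x₁-inverse = inverts x₁ a pp inverse ; x₁-hasCF = x₁-hasCF }
    where
    inverts : ∀ y a → PolyPart a x → ((x -L a) *L y) ≈L 1L → (x -L A 0) *L y ≋ 1L
    inverts y a pp inverse =
      L.trans (*L-cong (+L-cong (L.refl {x}) (-L-cong (PolyPart-unique {A 0} {a} {x} (Level.lower (hx 0)) pp))) (L.refl {y}))
              (coeffwise {(x -L a) *L y} {1L} inverse)
    x₁-hasCF : HasCF x₁ (A ∘ suc)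
    x₁-hasCF k with hx (suc k)
    ... | a′ , y , pp′ , inverse′ , pq =
      PQ-cong k (inverse-unique {y} {x -L A 0} (L.trans (L.*-comm y (x -L A 0)) (inverts y a′ pp′ inverse′))
                                               (inverts x₁ a pp inverse))
                pq

  x₁≋a₁+x′ : ∀ {x A} (hx : HasCF x A) → let open CompleteQuotient (completeQuotient hx) in
             x₁ ≋ A 1 +L (x₁ -L A 1)
  x₁≋a₁+x′ {A = A} hx = L.sym (L.trans (L.+-comm (A 1) (x₁ -L A 1)) (LP.//-rightDividesˡ (A 1) x₁))
    where open CompleteQuotient (completeQuotient hx)

  fractionalCF : (ℕ → LS) → ℕ → LS
  fractionalCF A zero = 0L
  fractionalCF A (suc k) = A (suc k)

  HasCF-fractional : ∀ {x A} → HasCF x A → HasCF (x -L A 0) (fractionalCF A)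
  HasCF-fractional {x} {A} hx zero = Level.lift (PolyPart-0L (Deg≤-fractional {A 0} {x} (Level.lower (hx 0))))
  HasCF-fractional {x} {A} hx (suc j) with hx (suc j)
  ... | a , y , pp , inverse , rest =
      0L , y , PolyPart-0L (Deg≤-fractional {A 0} {x} (Level.lower (hx 0)))
    , ≋⇒≈L (L.trans (*L-cong (L.trans (L.trans (+L-cong (L.refl {x -L A 0}) LP.-0#≈0#) (L.+-identityʳ (x -L A 0)))
                                      (+L-cong (L.refl {x}) (-L-cong (PolyPart-unique {A 0} {a} {x} (Level.lower (hx 0)) pp))))
                             (L.refl {y}))
                    (coeffwise {(x -L a) *L y} {1L} inverse))
    , rest

  -- Below, d k is the degree of the partial quotient aₖ₊₁.

  -- deg qₙ for the denominator qₙ of the n-th convergent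
  totalDegree : ℕ → (ℕ → ℕ) → ℕ
  totalDegree zero d = 0
  totalDegree (suc n) d = d 0 ℕ.+ totalDegree n (d ∘ suc)

  -- perturbations of degree below -2 deg qₙ leave a₀, …, aₙ unchanged
  perturbationDegree : ℕ → (ℕ → ℕ) → ℤ
  perturbationDegree n d = -[1+ 2 ℕ.* totalDegree n d ]

  -- deg (x - pₙ/qₙ) = -(2 deg qₙ + deg aₙ₊₁)
  errorDegree : ℕ → (ℕ → ℕ) → ℤ
  errorDegree n d = -ℤ + (2 ℕ.* totalDegree n d ℕ.+ d n)

  2*[a+s]≡a+[a+2*s] : ∀ a s → 2 ℕ.* (a ℕ.+ s) ≡ a ℕ.+ (a ℕ.+ 2 ℕ.* s)
  2*[a+s]≡a+[a+2*s] = ℕ-Solver.solve-∀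

  perturbation-below-1 : ∀ n d → perturbationDegree (suc n) d +ℤ + d 0 ≤ -ℤ 1ℤ
  perturbation-below-1 n d =
    ℤP.≤-trans (ℤP.≤-reflexive (PE.trans (PE.cong (λ m → -[1+ m ] +ℤ + d 0) (2*[a+s]≡a+[a+2*s] (d 0) S))
                                         (-[1+a+r]+a≡-[1+r] (d 0) (d 0 ℕ.+ 2 ℕ.* S))))
               (ℤ.-≤- ℕ.z≤n)
    where
    S = totalDegree n (d ∘ suc)

  perturbation-step : ∀ n d → + d 0 +ℤ ((perturbationDegree (suc n) d +ℤ + d 0) +ℤ 0ℤ) ≡ perturbationDegree n (d ∘ suc)
  perturbation-step n d = begin
    + d 0 +ℤ ((-[1+ 2 ℕ.* (d 0 ℕ.+ S) ] +ℤ + d 0) +ℤ 0ℤ)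
      ≡⟨ PE.cong (+ d 0 +ℤ_) (ℤP.+-identityʳ (-[1+ 2 ℕ.* (d 0 ℕ.+ S) ] +ℤ + d 0)) ⟩
    + d 0 +ℤ (-[1+ 2 ℕ.* (d 0 ℕ.+ S) ] +ℤ + d 0)
      ≡⟨ PE.cong (λ m → + d 0 +ℤ (-[1+ m ] +ℤ + d 0)) (2*[a+s]≡a+[a+2*s] (d 0) S) ⟩
    + d 0 +ℤ (-[1+ d 0 ℕ.+ (d 0 ℕ.+ 2 ℕ.* S) ] +ℤ + d 0)
      ≡⟨ PE.cong (+ d 0 +ℤ_) (-[1+a+r]+a≡-[1+r] (d 0) (d 0 ℕ.+ 2 ℕ.* S)) ⟩
    + d 0 +ℤ -[1+ d 0 ℕ.+ 2 ℕ.* S ]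
      ≡⟨ ℤP.+-comm (+ d 0) -[1+ d 0 ℕ.+ 2 ℕ.* S ] ⟩
    -[1+ d 0 ℕ.+ 2 ℕ.* S ] +ℤ + d 0
      ≡⟨ -[1+a+r]+a≡-[1+r] (d 0) (2 ℕ.* S) ⟩
    -[1+ 2 ℕ.* S ] ∎
    where
    S = totalDegree n (d ∘ suc)
    open PE.≡-Reasoning

  errorDegree-step : ∀ n d → (-ℤ + d 0 +ℤ -ℤ + d 0) +ℤ errorDegree n (d ∘ suc) ≡ errorDegree (suc n) d
  errorDegree-step n d =
    PE.trans (PE.cong (_+ℤ errorDegree n (d ∘ suc)) (neg-+ (d 0) (d 0)))
    (PE.trans (neg-+ (d 0 ℕ.+ d 0) _) (PE.cong (λ m → -ℤ + m) (regroup (d 0) (totalDegree n (d ∘ suc)) (d (suc n)))))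
    where
    neg-+ : ∀ a b → -ℤ + a +ℤ -ℤ + b ≡ -ℤ + (a ℕ.+ b)
    neg-+ a b = PE.trans (PE.sym (ℤP.neg-distrib-+ (+ a) (+ b))) (PE.cong -ℤ_ (PE.sym (ℤP.pos-+ a b)))
    regroup : ∀ a s e → (a ℕ.+ a) ℕ.+ (2 ℕ.* s ℕ.+ e) ≡ 2 ℕ.* (a ℕ.+ s) ℕ.+ e
    regroup = ℕ-Solver.solve-∀

  errorDegree≤-1 : ∀ n d → 1 ℕ.≤ d n → errorDegree n d ≤ -ℤ 1ℤ
  errorDegree≤-1 n d 1≤dₙ = ℤP.neg-mono-≤ (ℤ.+≤+ (ℕP.≤-trans 1≤dₙ (ℕP.m≤n+m (d n) _)))

  totalDegree-suc : ∀ n d → totalDegree (suc n) d ≡ totalDegree n d ℕ.+ d n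
  totalDegree-suc zero d = ℕP.+-comm (d 0) 0
  totalDegree-suc (suc n) d =
    PE.trans (PE.cong (d 0 ℕ.+_) (totalDegree-suc n (d ∘ suc))) (PE.sym (ℕP.+-assoc (d 0) _ _))

  totalDegree-shift : ∀ n d e c → (∀ k → e k ≡ d k ℕ.+ c) → totalDegree n e ≡ totalDegree n d ℕ.+ n ℕ.* c
  totalDegree-shift zero d e c _ = PE.refl
  totalDegree-shift (suc n) d e c e≡d+c =
    PE.trans (PE.cong₂ ℕ._+_ (e≡d+c 0) (totalDegree-shift n (d ∘ suc) (e ∘ suc) c (e≡d+c ∘ suc)))
             (regroup (d 0) (totalDegree n (d ∘ suc)) n c)
    where
    regroup : ∀ a s n c → (a ℕ.+ c) ℕ.+ (s ℕ.+ n ℕ.* c) ≡ (a ℕ.+ s) ℕ.+ suc n ℕ.* c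
    regroup = ℕ-Solver.solve-∀

  open ReciprocalIdentities laurentRing using (reciprocal-perturbation; reciprocal-perturbation-difference; reciprocal-difference)

  PQ-perturb : ∀ n (d : ℕ → ℕ) {x A ε} → HasCF x A → (∀ k → Deg≤ (+ d k) (A (suc k))) →
               Deg≤ (perturbationDegree n d) ε → PQ n (x +L ε) (A n)
  PQ-perturb zero d {x} {A} hx hA hε = Level.lift (PolyPart-perturb {A 0} {x} (Level.lower (hx 0)) hε)
  -- 1/((x - a₀) + ε) = x₁ w with w = 1/(1 + ε x₁), and x₁ w = x₁ + ε′ with ε′ = -x₁ (ε x₁) w.
  PQ-perturb (suc n) d {x} {A} {ε} hx hA hε =
      A 0 , y , PolyPart-perturb {A 0} {x} (Level.lower (hx 0)) (Deg≤-weaken (ℤ.-≤- ℕ.z≤n) hε)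
    , ≋⇒≈L (L.trans (*L-cong (+L-swapʳ x ε (-L A 0)) (L.refl {y}))
                    (reciprocal-perturbation (x -L A 0) ε x₁ w x₁-inverse (*L-reciprocal1+ Deg≤-εx₁)))
    , PQ-cong n x₁+ε′≋y (PQ-perturb n (d ∘ suc) x₁-hasCF (hA ∘ suc) Deg≤-ε′)
    where
    open CompleteQuotient (completeQuotient hx)
    Deg≤-x₁ : Deg≤ (+ d 0) x₁
    Deg≤-x₁ = Deg≤-cong (L.sym (x₁≋a₁+x′ hx))
                        (Deg≤-+L (hA 0) (Deg≤-weaken ℤ.-≤+ (Deg≤-fractional {A 1} {x₁} (Level.lower (x₁-hasCF 0)))))
    Deg≤-εx₁ : Deg≤ (-ℤ 1ℤ) (ε *L x₁)
    Deg≤-εx₁ = Deg≤-weaken (perturbation-below-1 n d) (Deg≤-*L hε Deg≤-x₁)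
    w = reciprocal1+ (ε *L x₁)
    y = x₁ *L w
    ε′ = y -L x₁
    x₁+ε′≋y : x₁ +L ε′ ≋ y
    x₁+ε′≋y = L.trans (L.+-comm x₁ ε′) (LP.//-rightDividesˡ x₁ y)
    Deg≤-ε′ : Deg≤ (perturbationDegree n (d ∘ suc)) ε′
    Deg≤-ε′ = Deg≤-cong (L.sym (reciprocal-perturbation-difference ε x₁ w (*L-reciprocal1+ Deg≤-εx₁)))
                (Deg≤--L (Deg≤-weaken (ℤP.≤-reflexive (perturbation-step n d))
                  (Deg≤-*L Deg≤-x₁ (Deg≤-*L (Deg≤-*L hε Deg≤-x₁) (deg≤-bound w)))))

  sign : ℕ → Carrier
  sign zero = 1#
  sign (suc n) = -K sign n

  sign≉0 : ∀ n → ¬ (sign n ≈ 0#)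
  sign≉0 zero 1≈0 = Field.0≉1 K (sym 1≈0)
  sign≉0 (suc n) -s≈0 = sign≉0 n (trans (sym (KP.-‿involutive (sign n))) (trans (-‿cong -s≈0) KP.-0#≈0#))

  reciprocal-of-fractional : ∀ {x A} (hx : HasCF x A) → A 0 ≋ 0L → let open CompleteQuotient (completeQuotient hx) in
                             x *L (A 1 +L (x₁ -L A 1)) ≋ 1L
  reciprocal-of-fractional {x} {A} hx A₀≋0 =
    L.trans (*L-cong (L.sym x-A₀≋x) (L.sym (x₁≋a₁+x′ hx))) x₁-inverse
    where
    open CompleteQuotient (completeQuotient hx)
    x-A₀≋x : x -L A 0 ≋ x
    x-A₀≋x = L.trans (+L-cong (L.refl {x}) (L.trans (-L-cong A₀≋0) LP.-0#≈0#)) (L.+-identityʳ x)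

  Leading-fractional : ∀ {x A m} → HasCF x A → A 0 ≋ 0L → Leading (+ m) 1# (A 1) → Leading (-ℤ + m) 1# x
  Leading-fractional {x} {A} hx A₀≋0 hA₁ =
    Leading-reciprocal {y = x}
      (Leading-+L-lower hA₁ (Deg≤-fractional {A 1} {x₁} (Level.lower (x₁-hasCF 0))) ℤ.-<+)
      (reciprocal-of-fractional hx A₀≋0)
    where open CompleteQuotient (completeQuotient hx)

  convergent-error : ∀ n (d : ℕ → ℕ) {x A u} → HasCF x A → A 0 ≋ 0L →
    (∀ k → Leading (+ d k) 1# (A (suc k))) → (∀ k → 1 ℕ.≤ d k) →
    FinCF (applyUpTo (A ∘ suc) n) u → Leading (errorDegree n d) (sign n) (x -L u)
  convergent-error zero d {x} {A} {u} hx A₀≋0 hA _ (Level.lift u≈0) =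
    Leading-cong (L.sym (L.trans (+L-cong (L.refl {x}) (L.trans (-L-cong (coeffwise {u} {0L} u≈0)) LP.-0#≈0#))
                                 (L.+-identityʳ x)))
                 (Leading-fractional hx A₀≋0 (hA 0))
  -- x = 1/(a₁ + x′) and u = 1/(a₁ + w) with w = [0; a₂, …, aₙ₊₁], so x - u = -x u (x′ - w).
  convergent-error (suc n) d {x} {A} {u} hx A₀≋0 hA 1≤d (w , fw , [A₁+w]u≈1) =
    Leading-cong (L.sym (reciprocal-difference (A 1) x x′ u w [A₁+w]u≋1 (reciprocal-of-fractional hx A₀≋0)))
      (Leading-coeff-cong (-‿cong (trans (*-cong (*-identityˡ 1#) refl) (*-identityˡ _)))
        (Leading-index (errorDegree-step n d)
          (Leading--L (Leading-*L (Leading-*L (Leading-fractional hx A₀≋0 (hA 0)) Leading-u) IH))))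
    where
    open CompleteQuotient (completeQuotient hx)
    x′ = x₁ -L A 1
    [A₁+w]u≋1 : (A 1 +L w) *L u ≋ 1L
    [A₁+w]u≋1 = coeffwise {(A 1 +L w) *L u} {1L} [A₁+w]u≈1
    IH : Leading (errorDegree n (d ∘ suc)) (sign n) (x′ -L w)
    IH = convergent-error n (d ∘ suc) (HasCF-fractional x₁-hasCF) (L.refl {0L}) (hA ∘ suc) (1≤d ∘ suc) fw
    x′-[x′-w]≋w : x′ -L (x′ -L w) ≋ w
    x′-[x′-w]≋w = L.trans (+L-cong (L.refl {x′}) (LP.⁻¹-anti-homo‿- x′ w))
                          (L.trans (L.+-comm x′ (w -L x′)) (LP.//-rightDividesˡ x′ w))
    Deg≤-w : Deg≤ (-ℤ 1ℤ) w
    Deg≤-w = Deg≤-cong x′-[x′-w]≋w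
               (Deg≤-sub (Deg≤-fractional {A 1} {x₁} (Level.lower (x₁-hasCF 0)))
                         (Deg≤-weaken (errorDegree≤-1 n (d ∘ suc) (1≤d (suc n))) (leadingDeg≤ IH)))
    Leading-u : Leading (-ℤ + d 0) 1# u
    Leading-u = Leading-reciprocal {y = u} (Leading-+L-lower (hA 0) Deg≤-w ℤ.-<+)
                                   (L.trans (L.*-comm u (A 1 +L w)) [A₁+w]u≋1)

module ExampleExpansions {c ℓ : Level} (K : Field c ℓ) where
  open ContinuedFractionLemmas K public
  open SetoidReasoning L.setoid

  bDeg cDeg : ℕ → ℕ
  bDeg k = 4 ℕ.* k ℕ.+ 1
  cDeg k = 4 ℕ.* k ℕ.+ 3

  totalDegree-cDeg : ∀ n → totalDegree n cDeg ≡ totalDegree n bDeg ℕ.+ n ℕ.* 2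
  totalDegree-cDeg n = totalDegree-shift n bDeg cDeg 2 (λ k → PE.sym (ℕP.+-assoc (4 ℕ.* k) 1 2))

  errorDegree-c<b : ∀ n → errorDegree n cDeg < errorDegree n bDeg
  errorDegree-c<b n = -neg<-neg (ℕP.≤-trans (ℕP.m≤m+n _ (bDeg n)) (ℕP.≤-reflexive (PE.sym
    (PE.trans (PE.cong (λ C → 2 ℕ.* C ℕ.+ cDeg n) (totalDegree-cDeg n)) (regroup (totalDegree n bDeg) n)))))
    where
    regroup : ∀ B n → 2 ℕ.* (B ℕ.+ n ℕ.* 2) ℕ.+ (4 ℕ.* n ℕ.+ 3) ≡ suc (2 ℕ.* B ℕ.+ (4 ℕ.* n ℕ.+ 1)) ℕ.+ (4 ℕ.* n ℕ.+ 1)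
    regroup = ℕ-Solver.solve-∀

  errorDegree-b<c : ∀ n → errorDegree (suc n) bDeg < errorDegree n cDeg
  errorDegree-b<c n = -neg<-neg (ℕP.≤-trans (ℕP.m≤m+n _ (cDeg n)) (ℕP.≤-reflexive (PE.sym
    (PE.trans (PE.cong (λ B → 2 ℕ.* B ℕ.+ bDeg (suc n)) (totalDegree-suc n bDeg))
              (PE.trans (regroup (totalDegree n bDeg) n)
                        (PE.cong (λ C → suc (2 ℕ.* C ℕ.+ cDeg n) ℕ.+ cDeg n) (PE.sym (totalDegree-cDeg n))))))))
    where
    regroup : ∀ B n → 2 ℕ.* (B ℕ.+ (4 ℕ.* n ℕ.+ 1)) ℕ.+ (4 ℕ.* suc n ℕ.+ 1)
                      ≡ suc (2 ℕ.* (B ℕ.+ n ℕ.* 2) ℕ.+ (4 ℕ.* n ℕ.+ 3)) ℕ.+ (4 ℕ.* n ℕ.+ 3)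
    regroup = ℕ-Solver.solve-∀

  errorDegree-c≡perturbationDegree-b : ∀ n → errorDegree n cDeg ≡ perturbationDegree (suc n) bDeg
  errorDegree-c≡perturbationDegree-b n = PE.cong (λ m → -ℤ + m) (PE.sym
    (PE.trans (PE.cong (λ B → suc (2 ℕ.* B)) (totalDegree-suc n bDeg))
    (PE.trans (regroup (totalDegree n bDeg) n) (PE.cong (λ C → 2 ℕ.* C ℕ.+ cDeg n) (PE.sym (totalDegree-cDeg n))))))
    where
    regroup : ∀ B n → suc (2 ℕ.* (B ℕ.+ (4 ℕ.* n ℕ.+ 1))) ≡ 2 ℕ.* (B ℕ.+ n ℕ.* 2) ℕ.+ (4 ℕ.* n ℕ.+ 3)
    regroup = ℕ-Solver.solve-∀

  errorDegree-b≡perturbationDegree-c : ∀ n → errorDegree (suc n) bDeg ≡ perturbationDegree (suc n) cDeg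
  errorDegree-b≡perturbationDegree-c n = PE.cong (λ m → -ℤ + m) (PE.sym
    (PE.trans (PE.cong (λ C → suc (2 ℕ.* C)) (totalDegree-cDeg (suc n))) (regroup (totalDegree (suc n) bDeg) n)))
    where
    regroup : ∀ B n → suc (2 ℕ.* (B ℕ.+ suc n ℕ.* 2)) ≡ 2 ℕ.* B ℕ.+ (4 ℕ.* suc n ℕ.+ 1)
    regroup = ℕ-Solver.solve-∀

  1≤bDeg : ∀ k → 1 ℕ.≤ bDeg k
  1≤bDeg k = ℕP.m≤n+m 1 (4 ℕ.* k)

  1≤cDeg : ∀ k → 1 ℕ.≤ cDeg k
  1≤cDeg k = ℕP.≤-trans (ℕ.s≤s ℕ.z≤n) (ℕP.m≤n+m 3 (4 ℕ.* k))

  β-error : ∀ {β} u n → HasCF β bSeq → FinCF (bList n) u → Leading (errorDegree n bDeg) (sign n) (β -L u)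
  β-error u n hβ fu = convergent-error n bDeg hβ (L.refl {0L}) (λ k → Leading-monomial (+ bDeg k)) 1≤bDeg
                              (PE.subst (λ bs → FinCF bs u) (map-applyUpTo id bPoly n) fu)

  γ-error : ∀ {γ} v n → HasCF γ cSeq → FinCF (cList n) v → Leading (errorDegree n cDeg) (sign n) (γ -L v)
  γ-error v n hγ fv = convergent-error n cDeg hγ (L.refl {0L}) (λ k → Leading-monomial (+ cDeg k)) 1≤cDeg
                              (PE.subst (λ cs → FinCF cs v) (map-applyUpTo id cPoly n) fv)

  errors-cancel : ∀ {α} β γ u v → α ≋ β +L γ → α ≋ u +L v → (β -L u) +L (γ -L v) ≋ 0L
  errors-cancel {α} β γ u v α≋β+γ α≋u+v = begin
    (β -L u) +L (γ -L v)          ≈⟨ +L-interchange β (-L u) γ (-L v) ⟩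
    (β +L γ) +L ((-L u) +L (-L v)) ≈⟨ +L-cong (L.sym α≋β+γ) (LP.-‿+-comm u v) ⟩
    α -L (u +L v)                 ≈⟨ +L-cong (L.refl {α}) (-L-cong (L.sym α≋u+v)) ⟩
    α -L α                        ≈⟨ L.-‿inverseʳ α ⟩
    0L                            ∎

  β+[γ-v]≋α-v : ∀ {α} β γ v → α ≋ β +L γ → β +L (γ -L v) ≋ α -L v
  β+[γ-v]≋α-v {α} β γ v α≋β+γ = L.trans (L.sym (L.+-assoc β γ (-L v))) (+L-cong (L.sym α≋β+γ) (L.refl { -L v}))

  γ+[β-u]≋α-u : ∀ {α} β γ u → α ≋ β +L γ → γ +L (β -L u) ≋ α -L u
  γ+[β-u]≋α-u β γ u α≋β+γ = β+[γ-v]≋α-v γ β u (L.trans α≋β+γ (L.+-comm β γ))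

proposition4p5 : ∀ {c ℓ : Level} (K : Field c ℓ) → let open Laurent K in
    (α β γ : LS) → HasCF β bSeq → HasCF γ cSeq → α ≈L (β +L γ) →
    (n : ℕ) → ProcedureStep α n
proposition4p5 K α β γ hβ hγ α≈β+γ n = no-stop-before-b , b-quotient , no-stop-before-c , c-quotient
  where
  open ExampleExpansions K
  α≋β+γ : α ≋ β +L γ
  α≋β+γ = coeffwise {α} {β +L γ} α≈β+γ
  no-stop-before-b : ∀ u v → FinCF (bList n) u → FinCF (cList n) v → ¬ (α ≈L (u +L v))
  no-stop-before-b u v fu fv α≈u+v =
    sign≉0 n (Leading-0L (Leading-cong (errors-cancel β γ u v α≋β+γ (coeffwise {α} {u +L v} α≈u+v))
      (Leading-+L-lower (β-error u n hβ fu) (leadingDeg≤ (γ-error v n hγ fv)) (errorDegree-c<b n))))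
  b-quotient : ∀ v → FinCF (cList n) v → PQ (suc n) (α -L v) (bPoly n)
  b-quotient v fv = PQ-cong (suc n) (β+[γ-v]≋α-v β γ v α≋β+γ)
    (PQ-perturb (suc n) bDeg hβ (λ k → Deg≤-monomial (+ bDeg k))
      (Deg≤-weaken (ℤP.≤-reflexive (errorDegree-c≡perturbationDegree-b n)) (leadingDeg≤ (γ-error v n hγ fv))))
  no-stop-before-c : ∀ u v → FinCF (bList (suc n)) u → FinCF (cList n) v → ¬ (α ≈L (u +L v))
  no-stop-before-c u v fu fv α≈u+v =
    sign≉0 n (Leading-0L (Leading-cong (L.trans (L.+-comm (γ -L v) (β -L u)) (errors-cancel β γ u v α≋β+γ (coeffwise {α} {u +L v} α≈u+v)))
      (Leading-+L-lower (γ-error v n hγ fv) (leadingDeg≤ (β-error u (suc n) hβ fu)) (errorDegree-b<c n))))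
  c-quotient : ∀ u → FinCF (bList (suc n)) u → PQ (suc n) (α -L u) (cPoly n)
  c-quotient u fu = PQ-cong (suc n) (γ+[β-u]≋α-u β γ u α≋β+γ)
    (PQ-perturb (suc n) cDeg hγ (λ k → Deg≤-monomial (+ cDeg k))
      (Deg≤-weaken (ℤP.≤-reflexive (errorDegree-b≡perturbationDegree-c n)) (leadingDeg≤ (β-error u (suc n) hβ fu))))
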